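{- Let $k\ge 4$ be an integer. Let $G_L$ be an $\ell$-$LP_0$-snark with $\ell\ge3$ and $\sigma$ link-vertices, and let $n=|V(G_L)|=7\ell+\sigma$. Then $i_{[kR]}(G_L)\ge \left\lceil \frac{(k+1)n}{4}\right\rceil+1$.
   Context: A basic block $B_i$ has vertices $p_i,q_i,r_i,s_i,t_i,u_i,v_i$ and edges $p_it_i,t_iq_i,q_ir_i,r_is_i,s_ip_i,u_iv_i,u_ip_i,v_iq_i$. For odd $\ell\ge3$, an $\ell$-$LP_1$-snark is built from disjoint blocks $B_0,\ldots,B_{\ell-1}$: for each $i\in\{0,\ldots,\ell-1\}$ (indices modulo $\ell$) add either the pair of edges $\{s_ir_{i+1},v_iu_{i+1}\}$ or the pair $\{s_iu_{i+1},v_ir_{i+1}\}$; then choose an odd number $\sigma$ with $1\le\sigma\le\lfloor\ell/3\rfloor$ of pairwise disjoint triples $\{t_i,t_j,t_s\}$ and for each add a new vertex (link-vertex) adjacent to its three vertices; finally, the remaining $\ell-3\sigma$ vertices $t_i$ are paired up and each pair is joined by an edge (repairing edge). An $\ell$-$LP_0$-snark is an $\ell$-$LP_1$-snark in which every link-vertex is adjacent to $t_i,t_{i+1},t_{i+2}$ for some $i$ and every repairing edge is of the form $t_it_{i+1}$ (indices modulo $\ell$). For $f\colon V(G)\to\mathbb{Z}_{\ge 0}$ and $S\subseteq V(G)$, $f(S)=\sum_{v\in S}f(v)$, and $AN(v)=\{w\in N(v): f(w)\ge 1\}$. A $[k]$-Roman dominating function of $G$ is a function $f\colon V(G)\to\{0,1,\ldots,k+1\}$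 such that $f(N[v])\ge k+|AN(v)|$ for every vertex $v$ with $f(v)<k$; its weight is $f(V(G))$. $i_{[kR]}(G)$ is the minimum weight of such a function whose set of vertices with positive label is independent. -}

module Defs where

open import Data.Nat using (ℕ; zero; suc; _+_; _*_; _∸_; _≤_; _<_; _≡ᵇ_; _/_; _%_)
open import Data.Bool using (Bool; true; false; if_then_else_; _∧_; _∨_; T)
open import Data.Fin using (Fin; toℕ)
open import Data.List using (List; []; _∷_; _++_; concatMap; allFin)
open import Data.Bool.ListAction using (any)
open import Data.Product using (_×_; _,_)
open import Relation.Nullary using (¬_)
open import Data.Empty using (⊥)

Σᶠ : (n : ℕ) → (Fin n → ℕ) → ℕ
Σᶠ zero    g = 0
Σᶠ (suc n) g = g Fin.zero + Σᶠ n (λ i → g (Fin.suc i))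

record Graph : Set where
  field
    order : ℕ
    adj   : Fin order → Fin order → Bool

open Graph public

Adj : (G : Graph) → Fin (order G) → Fin (order G) → Set
Adj G v w = T (adj G v w)

fClosedNbhd : (G : Graph) → (Fin (order G) → ℕ) → Fin (order G) → ℕ
fClosedNbhd G f v = f v + Σᶠ (order G) (λ w → if adj G v w then f w else 0)

activeNbrs : (G : Graph) → (Fin (order G) → ℕ) → Fin (order G) → ℕ
activeNbrs G f v =
  Σᶠ (order G) (λ w → if adj G v w then (if f w ≡ᵇ 0 then 0 else 1) else 0)

weight : (G : Graph) → (Fin (order G) → ℕ) → ℕ
weight G f = Σᶠ (order G) f

IsKRDF : ℕ → (G : Graph) → (Fin (order G) → ℕ) → Set
IsKRDF k G f =
  (∀ v → f v ≤ k + 1) ×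
  (∀ v → f v < k → k + activeNbrs G f v ≤ fClosedNbhd G f v)

PositiveIndependent : (G : Graph) → (Fin (order G) → ℕ) → Set
PositiveIndependent G f =
  ∀ v w → Adj G v w → 1 ≤ f v → 1 ≤ f w → ⊥

iKR-≥ : ℕ → Graph → ℕ → Set
iKR-≥ k G m = ∀ (f : Fin (order G) → ℕ) →
  IsKRDF k G f → PositiveIndependent G f → m ≤ weight G f

⌈_/4⌉ : ℕ → ℕ
⌈ m /4⌉ = (m + 3) / 4

-- Vertex numbering: in block B_i,
--   p_i = 7i, q_i = 7i+1, r_i = 7i+2, s_i = 7i+3, t_i = 7i+4,
--   u_i = 7i+5, v_i = 7i+6;
-- the m-th link-vertex is 7ℓ + m.
--
-- The link-vertices / repairing edges of an LP₀-snark partition the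
-- cycle ℤ_ℓ of indices of the t_i into cyclically consecutive triples
-- {i,i+1,i+2} and pairs {i,i+1}.  Such a partition is described by a
-- starting index `offset` and the list `blocks` of consecutive parts
-- read around the cycle (true = triple with a link-vertex,
-- false = pair joined by a repairing edge).

_mod_ : ℕ → ℕ → ℕ
a mod zero    = a
a mod (suc l) = a % suc l

Edge : Set
Edge = ℕ × ℕ

pV qV rV sV tV uV vV : ℕ → ℕ
pV i = 7 * i
qV i = 7 * i + 1
rV i = 7 * i + 2
sV i = 7 * i + 3
tV i = 7 * i + 4
uV i = 7 * i + 5
vV i = 7 * i + 6

blockEdges : ℕ → List Edge
blockEdges i =
  (pV i , tV i) ∷ (tV i , qV i) ∷ (qV i , rV i) ∷ (rV i , sV i) ∷
  (sV i , pV i) ∷ (uV i , vV i) ∷ (uV i , pV i) ∷ (vV i , qV i) ∷ []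

connEdges : (ℓ : ℕ) → Bool → ℕ → List Edge
connEdges ℓ true  i = (sV i , rV ((suc i) mod ℓ)) ∷ (vV i , uV ((suc i) mod ℓ)) ∷ []
connEdges ℓ false i = (sV i , uV ((suc i) mod ℓ)) ∷ (vV i , rV ((suc i) mod ℓ)) ∷ []

tMod : ℕ → ℕ → ℕ
tMod ℓ a = tV (a mod ℓ)

-- link-vertex edges and repairing edges; a = current position on the
-- cycle, m = number of link-vertices created so far
linkEdges : (ℓ : ℕ) → ℕ → ℕ → List Bool → List Edge
linkEdges ℓ a m []            = []
linkEdges ℓ a m (true  ∷ bs) =
  (7 * ℓ + m , tMod ℓ a) ∷ (7 * ℓ + m , tMod ℓ (a + 1)) ∷
  (7 * ℓ + m , tMod ℓ (a + 2)) ∷ linkEdges ℓ (a + 3) (suc m) bs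
linkEdges ℓ a m (false ∷ bs) =
  (tMod ℓ a , tMod ℓ (a + 1)) ∷ linkEdges ℓ (a + 2) m bs

partSize : Bool → ℕ
partSize true  = 3
partSize false = 2

totalSize : List Bool → ℕ
totalSize []       = 0
totalSize (b ∷ bs) = partSize b + totalSize bs

numTriples : List Bool → ℕ
numTriples []           = 0
numTriples (true  ∷ bs) = suc (numTriples bs)
numTriples (false ∷ bs) = numTriples bs

snarkEdges : (ℓ : ℕ) → (Fin ℓ → Bool) → ℕ → List Bool → List Edge
snarkEdges ℓ conn offset blocks =
  concatMap (λ i → blockEdges (toℕ i) ++ connEdges ℓ (conn i) (toℕ i)) (allFin ℓ)
  ++ linkEdges ℓ offset 0 blocks

edgeBetween : ℕ → ℕ → Edge → Bool
edgeBetween x y (a , b) = ((a ≡ᵇ x) ∧ (b ≡ᵇ y)) ∨ ((a ≡ᵇ y) ∧ (b ≡ᵇ x))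

LP0Snark : (ℓ : ℕ) → (Fin ℓ → Bool) → ℕ → List Bool → Graph
LP0Snark ℓ conn offset blocks = record
  { order = 7 * ℓ + numTriples blocks
  ; adj   = λ v w → any (edgeBetween (toℕ v) (toℕ w)) (snarkEdges ℓ conn offset blocks)
  }

{-# OPTIONS --safe #-}
module Submission where

-- Let f be a [k]-Roman dominating function (k ≥ 4) whose positive vertices form an independent
-- set S.  Then f takes only the values 0, k and k + 1, and we discharge: a vertex labelled n
-- keeps 2(k+1) + 7 if n = k and 2(k+1) if n = k + 1, and sends (k+1)(n − (k−1)) to each of its
-- neighbours.  With at most three neighbours, what a vertex keeps and sends is at most 8n, so the
-- total charge is at most 8 w(f).  Every vertex ends up with at least 2(k+1), and with at least
-- 2(k+1) + 7 if it is labelled k, or if no vertex is labelled k and it has two labelled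
-- neighbours; if such a vertex exists, 8 w(f) ≥ 2(k+1) n + 7, i.e. 4 w(f) ≥ (k+1) n + 4.
-- Otherwise S is a perfect code, and an LP₀-snark has none.  Inside a block, t ∉ S forces
-- p ∉ S (else t, s or u would have two code neighbours) and likewise q ∉ S, so the code
-- neighbour of t is its third neighbour.  For a link vertex z adjacent to t_a, t_{a+1}, t_{a+2},
-- t_a and t_{a+1} are not both in S, hence z ∈ S, and each of the three blocks has {s, v} ⊆ S or
-- {r, u} ⊆ S.  Whichever pair of edges joins B_i to B_{i+1}, r_{i+1} is adjacent to s_i or v_i
-- and s_i to r_{i+1} or u_{i+1}, so the choice in B_{a+1} clashes with that in B_a or in B_{a+2}.

open import Data.Bool using (Bool; true; false; if_then_else_; _∧_; _∨_; T)
import Data.Bool as Bool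
open import Data.Bool.ListAction using (any; or)
open import Data.Bool.Properties using (¬-not; ∨-comm; T-∨; T-∧)
open import Data.Empty using (⊥; ⊥-elim)
open import Data.Fin using (Fin; zero; suc; toℕ; fromℕ<)
open import Data.Fin.Patterns using (0F; 1F; 2F; 3F; 4F; 5F; 6F)
import Data.Fin.Properties as Fin
open import Data.List using (List; []; _∷_; _++_; length; map; concatMap; tabulate; allFin)
open import Data.List.Membership.Propositional using (_∈_; lose)
open import Data.List.Membership.Propositional.Properties using (∈-++⁺ˡ; ∈-++⁺ʳ; ∈-concatMap⁺; ∈-allFin)
open import Data.List.Properties using (map-cong)
open import Data.List.Relation.Unary.All using (All; []; _∷_)
import Data.List.Relation.Unary.All as All
open import Data.List.Relation.Unary.AllPairs using ([]; _∷_)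
open import Data.List.Relation.Unary.Any using (here; there)
open import Data.List.Relation.Unary.Any.Properties using (any⁺)
open import Data.List.Relation.Unary.Unique.Propositional using (Unique)
open import Data.Nat using (ℕ; NonZero; zero; suc; pred; _+_; _*_; _∸_; _≤_; _<_; _≡ᵇ_; z≤n; s≤s;
                            _%_; _/_; _≟_; _≤?_; _<?_)
open import Data.Nat.DivMod using (%-distribˡ-+; m<n⇒m%n≡m; m%n<n; m≤n⇒[n∸m]%m≡n%m; m≡m%n+[m/n]*n; m<n*o⇒m/o<n)
open import Data.Nat.Properties
open import Data.Nat.Tactic.RingSolver using (solve-∀)
open import Algebra.Properties.CommutativeSemigroup +-commutativeSemigroup using (x∙yz≈y∙xz)
open import Algebra.Properties.Semiring.Sum +-*-semiring using (sum; ∑-distrib-+; ∑-comm; *-distribˡ-sum)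
open import Data.Product using (_×_; _,_; proj₁; proj₂; ∃-syntax)
open import Data.Sum using (_⊎_; inj₁; inj₂; [_,_]′)
open import Data.Unit using (tt)
open import Data.Vec.Functional using (updateAt)
open import Data.Vec.Functional.Properties using (updateAt-minimal)
open import Defs
open import Function using (_∘_; id; const; case_of_)
open import Function.Bundles using (Equivalence)
open import Relation.Binary.Definitions using (tri<; tri≈; tri>)
open import Relation.Binary.PropositionalEquality
open import Relation.Nullary using (¬_; yes; no)
open import Relation.Nullary.Decidable using (¬¬-excluded-middle; dec-true; dec-false; from-yes)

-- Finite sums

𝟙 : Bool → ℕ
𝟙 b = if b then 1 else 0

𝟙-∨ : ∀ a b → 𝟙 (a ∨ b) ≤ 𝟙 a + 𝟙 b
𝟙-∨ true  b = s≤s z≤n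
𝟙-∨ false b = ≤-refl

𝟙-∧ : ∀ a b → 𝟙 (a ∧ b) ≡ 𝟙 a * 𝟙 b
𝟙-∧ true  b = sym (+-identityʳ (𝟙 b))
𝟙-∧ false b = refl

if-then-0≡*𝟙 : ∀ b c → (if b then c else 0) ≡ c * 𝟙 b
if-then-0≡*𝟙 true  c = sym (*-identityʳ c)
if-then-0≡*𝟙 false c = sym (*-zeroʳ c)

Σᶠ≡sum : ∀ {n} (g : Fin n → ℕ) → Σᶠ n g ≡ sum g
Σᶠ≡sum {zero}  g = refl
Σᶠ≡sum {suc n} g = cong (g zero +_) (Σᶠ≡sum (g ∘ suc))

Σᶠ-cong : ∀ {n} {g h : Fin n → ℕ} → (∀ i → g i ≡ h i) → Σᶠ n g ≡ Σᶠ n h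
Σᶠ-cong {zero}  eq = refl
Σᶠ-cong {suc n} eq = cong₂ _+_ (eq zero) (Σᶠ-cong (eq ∘ suc))

Σᶠ-mono-≤ : ∀ {n} {g h : Fin n → ℕ} → (∀ i → g i ≤ h i) → Σᶠ n g ≤ Σᶠ n h
Σᶠ-mono-≤ {zero}  le = z≤n
Σᶠ-mono-≤ {suc n} le = +-mono-≤ (le zero) (Σᶠ-mono-≤ (le ∘ suc))

Σᶠ-const : ∀ n c → Σᶠ n (const c) ≡ n * c
Σᶠ-const zero    c = refl
Σᶠ-const (suc n) c = cong (c +_) (Σᶠ-const n c)

Σᶠ-zero : ∀ {n} {g : Fin n → ℕ} → (∀ i → g i ≡ 0) → Σᶠ n g ≡ 0
Σᶠ-zero {n} g≡0 = trans (Σᶠ-cong g≡0) (trans (Σᶠ-const n 0) (*-zeroʳ n))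

Σᶠ-distrib-+ : ∀ {n} (g h : Fin n → ℕ) → Σᶠ n (λ i → g i + h i) ≡ Σᶠ n g + Σᶠ n h
Σᶠ-distrib-+ g h rewrite Σᶠ≡sum (λ i → g i + h i) | Σᶠ≡sum g | Σᶠ≡sum h = ∑-distrib-+ g h

*-distribˡ-Σᶠ : ∀ {n} c (g : Fin n → ℕ) → c * Σᶠ n g ≡ Σᶠ n (λ i → c * g i)
*-distribˡ-Σᶠ c g rewrite Σᶠ≡sum g | Σᶠ≡sum (λ i → c * g i) = *-distribˡ-sum c g

Σᶠ-comm : ∀ {m n} (g : Fin m → Fin n → ℕ) →
          Σᶠ m (λ i → Σᶠ n (g i)) ≡ Σᶠ n (λ j → Σᶠ m (λ i → g i j))
Σᶠ-comm {m} {n} g = begin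
  Σᶠ m (λ i → Σᶠ n (g i))          ≡⟨ Σᶠ≡∑∑ g ⟩
  sum (λ i → sum (g i))            ≡⟨ ∑-comm g ⟩
  sum (λ j → sum (λ i → g i j))    ≡⟨ Σᶠ≡∑∑ (λ j i → g i j) ⟨
  Σᶠ n (λ j → Σᶠ m (λ i → g i j))  ∎
  where
  open ≡-Reasoning
  Σᶠ≡∑∑ : ∀ {m n} (h : Fin m → Fin n → ℕ) → Σᶠ m (λ i → Σᶠ n (h i)) ≡ sum (λ i → sum (h i))
  Σᶠ≡∑∑ {m} h = trans (Σᶠ-cong {m} (λ i → Σᶠ≡sum (h i))) (Σᶠ≡sum (λ i → sum (h i)))

Σᶠ-updateAt : ∀ {n} (g : Fin n → ℕ) a → Σᶠ n g ≡ g a + Σᶠ n (updateAt g a (const 0))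
Σᶠ-updateAt {suc n} g zero    = refl
Σᶠ-updateAt {suc n} g (suc a) = begin
  g zero + Σᶠ n (g ∘ suc)                                      ≡⟨ cong (g zero +_) (Σᶠ-updateAt (g ∘ suc) a) ⟩
  g zero + (g (suc a) + Σᶠ n (updateAt (g ∘ suc) a (const 0)))  ≡⟨ x∙yz≈y∙xz (g zero) (g (suc a)) _ ⟩
  g (suc a) + (g zero + Σᶠ n (updateAt (g ∘ suc) a (const 0)))  ∎
  where open ≡-Reasoning

Σᶠ-≥-term : ∀ {n} (g : Fin n → ℕ) a → g a ≤ Σᶠ n g
Σᶠ-≥-term g a rewrite Σᶠ-updateAt g a = m≤m+n (g a) _

Σᶠ-≥-with-surplus : ∀ {n} {g : Fin n → ℕ} m e a → (∀ i → m ≤ g i) → m + e ≤ g a → n * m + e ≤ Σᶠ n g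
Σᶠ-≥-with-surplus {n} {g} m e a m≤g m+e≤ga = begin
  n * m + e                              ≤⟨ +-monoʳ-≤ (n * m) e≤ga∸m ⟩
  n * m + (g a ∸ m)                      ≤⟨ +-monoʳ-≤ (n * m) (Σᶠ-≥-term (λ i → g i ∸ m) a) ⟩
  n * m + Σᶠ n (λ i → g i ∸ m)           ≡⟨ cong (_+ Σᶠ n (λ i → g i ∸ m)) (Σᶠ-const n m) ⟨
  Σᶠ n (const m) + Σᶠ n (λ i → g i ∸ m)  ≡⟨ Σᶠ-distrib-+ (const m) (λ i → g i ∸ m) ⟨
  Σᶠ n (λ i → m + (g i ∸ m))             ≡⟨ Σᶠ-cong (λ i → m+[n∸m]≡n (m≤g i)) ⟩
  Σᶠ n g                                 ∎
  where
  open ≤-Reasoning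
  e≤ga∸m : e ≤ g a ∸ m
  e≤ga∸m = subst (_≤ g a ∸ m) (m+n∸m≡n m e) (∸-monoˡ-≤ m m+e≤ga)

Σᶠ-≥-length : ∀ {n} {g : Fin n → ℕ} (xs : List (Fin n)) → Unique xs →
              All (λ x → 1 ≤ g x) xs → length xs ≤ Σᶠ n g
Σᶠ-≥-length         []       _               _              = z≤n
Σᶠ-≥-length {n} {g} (x ∷ xs) (x∉xs ∷ unique) (gx≥1 ∷ gxs≥1) = begin
  1 + length xs
    ≤⟨ +-mono-≤ gx≥1 (Σᶠ-≥-length xs unique (All.zipWith kept-by-update (x∉xs , gxs≥1))) ⟩
  g x + Σᶠ n (updateAt g x (const 0))
    ≡⟨ Σᶠ-updateAt g x ⟨
  Σᶠ n g
    ∎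
  where
  open ≤-Reasoning
  kept-by-update : ∀ {y} → x ≢ y × 1 ≤ g y → 1 ≤ updateAt g x (const 0) y
  kept-by-update {y} (x≢y , gy≥1) = subst (1 ≤_) (sym (updateAt-minimal y x g (x≢y ∘ sym))) gy≥1

Σᶠ-positive : ∀ {n} (g : Fin n → ℕ) → 1 ≤ Σᶠ n g → ∃[ i ] 1 ≤ g i
Σᶠ-positive {suc n} g Σ≥1 with g zero in eq
... | suc _ = zero , subst (1 ≤_) (sym eq) (s≤s z≤n)
... | zero  = let i , gi≥1 = Σᶠ-positive (g ∘ suc) Σ≥1 in suc i , gi≥1

Σᶠ-𝟙-≤1 : ∀ {n} (p : Fin n → Bool) → (∀ i j → T (p i) → T (p j) → i ≡ j) → Σᶠ n (𝟙 ∘ p) ≤ 1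
Σᶠ-𝟙-≤1 {zero}  p unique = z≤n
Σᶠ-𝟙-≤1 {suc n} p unique with p zero in eq
... | true  = ≤-reflexive (cong suc (Σᶠ-zero rest≡0))
  where
  rest≡0 : ∀ i → 𝟙 (p (suc i)) ≡ 0
  rest≡0 i with p (suc i) in eq′
  ... | true  = case unique zero (suc i) (subst T (sym eq) tt) (subst T (sym eq′) tt) of λ ()
  ... | false = refl
... | false = Σᶠ-𝟙-≤1 (p ∘ suc) (λ i j pi pj → Fin.suc-injective (unique (suc i) (suc j) pi pj))

Σᶠ-*𝟙-≤ : ∀ {n} c (p : Fin n → Bool) → (∀ i j → T (p i) → T (p j) → i ≡ j) →
          Σᶠ n (λ i → c * 𝟙 (p i)) ≤ c
Σᶠ-*𝟙-≤ {n} c p unique = begin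
  Σᶠ n (λ i → c * 𝟙 (p i))  ≡⟨ *-distribˡ-Σᶠ c (𝟙 ∘ p) ⟨
  c * Σᶠ n (𝟙 ∘ p)          ≤⟨ *-monoʳ-≤ c (Σᶠ-𝟙-≤1 p unique) ⟩
  c * 1                     ≡⟨ *-identityʳ c ⟩
  c                         ∎
  where open ≤-Reasoning

-- Neighbourhood sums, degrees and perfect codes

nbrSum : (G : Graph) → Fin (order G) → (Fin (order G) → ℕ) → ℕ
nbrSum G y g = Σᶠ (order G) (λ x → if adj G y x then g x else 0)

degree : (G : Graph) → Fin (order G) → ℕ
degree G x = nbrSum G x (const 1)

Symmetric : Graph → Set
Symmetric G = ∀ v w → adj G v w ≡ adj G w v

MaxDegree≤ : ℕ → Graph → Set
MaxDegree≤ d G = ∀ x → degree G x ≤ d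

record PerfectCode (G : Graph) (C : Fin (order G) → Set) : Set where
  field
    independent : ∀ v w → Adj G v w → C v → C w → ⊥
    dominating  : ∀ v → ¬ C v → ∃[ w ] Adj G v w × C w
    uniquely    : ∀ v w w′ → ¬ C v → Adj G v w → Adj G v w′ → C w → C w′ → w ≡ w′

module _ (G : Graph) where

  private
    V : Set
    V = Fin (order G)

  nbrSum-mono-≤ : ∀ y {g h : V → ℕ} → (∀ x → g x ≤ h x) → nbrSum G y g ≤ nbrSum G y h
  nbrSum-mono-≤ y {g} {h} g≤h = Σᶠ-mono-≤ masked
    where
    masked : ∀ x → (if adj G y x then g x else 0) ≤ (if adj G y x then h x else 0)
    masked x with adj G y x
    ... | true  = g≤h x
    ... | false = z≤n

  *-distribˡ-nbrSum : ∀ y c (g : V → ℕ) → c * nbrSum G y g ≡ nbrSum G y (λ x → c * g x)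
  *-distribˡ-nbrSum y c g = trans (*-distribˡ-Σᶠ c (λ x → if adj G y x then g x else 0)) (Σᶠ-cong masked)
    where
    masked : ∀ x → c * (if adj G y x then g x else 0) ≡ (if adj G y x then c * g x else 0)
    masked x with adj G y x
    ... | true  = refl
    ... | false = *-zeroʳ c

  nbrSum-distrib-+ : ∀ y (g h : V → ℕ) → nbrSum G y (λ x → g x + h x) ≡ nbrSum G y g + nbrSum G y h
  nbrSum-distrib-+ y g h =
    trans (Σᶠ-cong masked) (Σᶠ-distrib-+ (λ x → if adj G y x then g x else 0) (λ x → if adj G y x then h x else 0))
    where
    masked : ∀ x → (if adj G y x then g x + h x else 0) ≡ (if adj G y x then g x else 0) + (if adj G y x then h x else 0)
    masked x with adj G y x
    ... | true  = refl
    ... | false = refl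

  handshake : Symmetric G → ∀ (g : V → ℕ) →
              Σᶠ (order G) (λ y → nbrSum G y g) ≡ Σᶠ (order G) (λ x → g x * degree G x)
  handshake symmetric g = begin
    Σᶠ n (λ y → Σᶠ n (λ x → if adj G y x then g x else 0))
      ≡⟨ Σᶠ-comm (λ y x → if adj G y x then g x else 0) ⟩
    Σᶠ n (λ x → Σᶠ n (λ y → if adj G y x then g x else 0))
      ≡⟨ Σᶠ-cong (λ x → Σᶠ-cong (λ y → if-then-0≡*𝟙 (adj G y x) (g x))) ⟩
    Σᶠ n (λ x → Σᶠ n (λ y → g x * 𝟙 (adj G y x)))
      ≡⟨ Σᶠ-cong (λ x → *-distribˡ-Σᶠ (g x) (λ y → 𝟙 (adj G y x))) ⟨
    Σᶠ n (λ x → g x * Σᶠ n (λ y → 𝟙 (adj G y x)))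
      ≡⟨ Σᶠ-cong (λ x → cong (g x *_) (Σᶠ-cong (λ y → cong 𝟙 (symmetric y x)))) ⟩
    Σᶠ n (λ x → g x * degree G x)
      ∎
    where
    open ≡-Reasoning
    n : ℕ
    n = order G

  nbrSum-positive : ∀ y (g : V → ℕ) → 1 ≤ nbrSum G y g → ∃[ x ] Adj G y x × 1 ≤ g x
  nbrSum-positive y g sum≥1 =
    let x , masked≥1 = Σᶠ-positive (λ x → if adj G y x then g x else 0) sum≥1
    in x , unmask (adj G y x) masked≥1
    where
    unmask : ∀ b {c} → 1 ≤ (if b then c else 0) → T b × 1 ≤ c
    unmask true c≥1 = tt , c≥1

  nbrSum-≥-length : ∀ y {g : V → ℕ} (xs : List V) → Unique xs →
                    All (λ x → Adj G y x × 1 ≤ g x) xs → length xs ≤ nbrSum G y g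
  nbrSum-≥-length y {g} xs unique nbrs = Σᶠ-≥-length xs unique (All.map masked nbrs)
    where
    masked : ∀ {x} → Adj G y x × 1 ≤ g x → 1 ≤ (if adj G y x then g x else 0)
    masked {x} (y~x , gx≥1) with adj G y x
    ... | true = gx≥1

  neighbour-among : MaxDegree≤ 3 G → ∀ x a b c w → Adj G x a → Adj G x b → Adj G x c →
                    a ≢ b → a ≢ c → b ≢ c → Adj G x w → w ≡ a ⊎ w ≡ b ⊎ w ≡ c
  neighbour-among Δ≤3 x a b c w x~a x~b x~c a≢b a≢c b≢c x~w
    with w Fin.≟ a | w Fin.≟ b | w Fin.≟ c
  ... | yes w≡a | _       | _       = inj₁ w≡a
  ... | no _    | yes w≡b | _       = inj₂ (inj₁ w≡b)
  ... | no _    | no _    | yes w≡c = inj₂ (inj₂ w≡c)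
  ... | no w≢a  | no w≢b  | no w≢c  = ⊥-elim (<⇒≱ (s≤s (Δ≤3 x)) four≤degree)
    where
    distinct : Unique (a ∷ b ∷ c ∷ w ∷ [])
    distinct = (a≢b ∷ a≢c ∷ (w≢a ∘ sym) ∷ []) ∷ (b≢c ∷ (w≢b ∘ sym) ∷ []) ∷ ((w≢c ∘ sym) ∷ []) ∷ []
             ∷ []
    four≤degree : 4 ≤ degree G x
    four≤degree = nbrSum-≥-length x (a ∷ b ∷ c ∷ w ∷ []) distinct
      ((x~a , ≤-refl) ∷ (x~b , ≤-refl) ∷ (x~c , ≤-refl) ∷ (x~w , ≤-refl) ∷ [])

module _ {G : Graph} {C : Fin (order G) → Set} (code : PerfectCode G C) where

  open PerfectCode code

  no-two-code-neighbours : ∀ x a b → Adj G x a → Adj G x b → C a → C b → a ≢ b → ⊥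
  no-two-code-neighbours x a b x~a x~b ca cb a≢b = ¬¬-excluded-middle λ
    { (yes cx) → independent x a x~a cx ca
    ; (no ¬cx) → a≢b (uniquely x a b ¬cx x~a x~b ca cb)
    }

  code-neighbour-among : MaxDegree≤ 3 G → ∀ x a b c → Adj G x a → Adj G x b → Adj G x c →
                         a ≢ b → a ≢ c → b ≢ c → ¬ C x → C a ⊎ C b ⊎ C c
  code-neighbour-among Δ≤3 x a b c x~a x~b x~c a≢b a≢c b≢c ¬cx
    with w , x~w , cw ← dominating x ¬cx
    with neighbour-among G Δ≤3 x a b c w x~a x~b x~c a≢b a≢c b≢c x~w
  ... | inj₁ refl        = inj₁ cw
  ... | inj₂ (inj₁ refl) = inj₂ (inj₁ cw)
  ... | inj₂ (inj₂ refl) = inj₂ (inj₂ cw)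

-- Discharging for [k]-Roman dominating functions with independent support

data Label (k : ℕ) : ℕ → Set where
  none   : Label k 0
  weak   : Label k k
  strong : Label k (suc k)

module _ {k : ℕ} where

  isWeak : ∀ {n} → Label k n → Bool
  isWeak weak = true
  isWeak _    = false

  excess : ∀ {n} → Label k n → ℕ
  excess none   = 0
  excess weak   = 1
  excess strong = 2

  sent : ∀ {n} → Label k n → ℕ
  sent l = suc k * excess l

  kept : ∀ {n} → Label k n → ℕ
  kept none   = 0
  kept weak   = 2 * suc k + 7
  kept strong = 2 * suc k

-- activeNbrs G f y is nbrSum G y (λ x → active (f x)) by computation.
active : ℕ → ℕ
active n = if n ≡ᵇ 0 then 0 else 1

active≤1 : ∀ n → active n ≤ 1
active≤1 zero    = z≤n
active≤1 (suc n) = ≤-refl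

active-positive : ∀ {n} → 1 ≤ n → 1 ≤ active n
active-positive (s≤s _) = ≤-refl

toLabel : ∀ {k} n → (1 ≤ n → k ≤ n) → n ≤ k + 1 → Label k n
toLabel zero _ _ = none
toLabel {k} (suc n) ≥k ≤k+1 with m≤n⇒m<n∨m≡n (≥k (s≤s z≤n))
... | inj₂ k≡1+n = subst (Label k) k≡1+n weak
... | inj₁ k<1+n = subst (Label k) (≤-antisym k<1+n (subst (suc n ≤_) (+-comm k 1) ≤k+1)) strong

excess-≥-active : ∀ {k n} (l : Label k n) → active n ≤ excess l
excess-≥-active         none   = z≤n
excess-≥-active {k}     weak   = active≤1 k
excess-≥-active         strong = s≤s z≤n

excess-≥-2*active : ∀ {k n} (l : Label k n) → isWeak l ≡ false → 2 * active n ≤ excess l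
excess-≥-2*active none   _ = z≤n
excess-≥-2*active strong _ = ≤-refl

≤-excess+pred*active : ∀ {k n} → 1 ≤ k → (l : Label k n) → n ≤ excess l + pred k * active n
≤-excess+pred*active         _ none   = z≤n
≤-excess+pred*active {suc k} _ weak   = ≤-reflexive (cong suc (sym (*-identityʳ k)))
≤-excess+pred*active {suc k} _ strong = ≤-reflexive (cong (2 +_) (sym (*-identityʳ k)))

kept-≥ : ∀ {k n} (l : Label k n) → 1 ≤ n → 2 * suc k ≤ kept l
kept-≥ weak   _ = m≤m+n _ 7
kept-≥ strong _ = ≤-refl

kept-weak : ∀ {k n} (l : Label k n) → isWeak l ≡ true → 2 * suc k + 7 ≤ kept l
kept-weak weak _ = ≤-refl

kept+sent*3≤8*n : ∀ {k n} → 4 ≤ k → (l : Label k n) → kept l + sent l * 3 ≤ 8 * n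
kept+sent*3≤8*n {k} _   none   = ≤-reflexive (cong (_* 3) (*-zeroʳ (suc k)))
kept+sent*3≤8*n {k} 4≤k weak   = begin
  2 * suc k + 7 + suc k * 1 * 3  ≡⟨ weak-sum k ⟩
  5 * k + 3 * 4                  ≤⟨ +-monoʳ-≤ (5 * k) (*-monoʳ-≤ 3 4≤k) ⟩
  5 * k + 3 * k                  ≡⟨ weak-bound k ⟩
  8 * k                          ∎
  where
  open ≤-Reasoning
  weak-sum : ∀ k → 2 * suc k + 7 + suc k * 1 * 3 ≡ 5 * k + 3 * 4
  weak-sum = solve-∀
  weak-bound : ∀ k → 5 * k + 3 * k ≡ 8 * k
  weak-bound = solve-∀
kept+sent*3≤8*n {k} _   strong = ≤-reflexive (strong-sum k)
  where
  strong-sum : ∀ k → 2 * suc k + suc k * 2 * 3 ≡ 8 * suc k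
  strong-sum = solve-∀

2*a+7≤2*b⇒a+4≤b : ∀ a b → 2 * a + 7 ≤ 2 * b → a + 4 ≤ b
2*a+7≤2*b⇒a+4≤b a b 2a+7≤2b = subst (_≤ b) (sym (+-suc a 3)) (*-cancelˡ-< 2 (a + 3) b (begin-strict
  2 * (a + 3)  ≡⟨ *-distribˡ-+ 2 a 3 ⟩
  2 * a + 6    <⟨ +-monoʳ-< (2 * a) ≤-refl ⟩
  2 * a + 7    ≤⟨ 2a+7≤2b ⟩
  2 * b        ∎))
  where open ≤-Reasoning

module Discharging (G : Graph) (symmetric : Symmetric G) (Δ≤3 : MaxDegree≤ 3 G)
  {k : ℕ} (4≤k : 4 ≤ k) {f : Fin (order G) → ℕ}
  (krdf : IsKRDF k G f) (indep : PositiveIndependent G f) where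

  private
    N : ℕ
    N = order G
    V : Set
    V = Fin N
    AN : V → ℕ
    AN = activeNbrs G f

  roman : ∀ v → f v < k → k + AN v ≤ f v + nbrSum G v f
  roman = proj₂ krdf

  nbrSum-of-labelled : ∀ v → 1 ≤ f v → nbrSum G v f ≡ 0
  nbrSum-of-labelled v fv≥1 = Σᶠ-zero masked
    where
    masked : ∀ w → (if adj G v w then f w else 0) ≡ 0
    masked w with adj G v w in v~w | f w in fw
    ... | false | _     = refl
    ... | true  | zero  = refl
    ... | true  | suc _ = ⊥-elim (indep v w (subst T (sym v~w) tt) fv≥1 (subst (1 ≤_) (sym fw) (s≤s z≤n)))

  labelled⇒≥k : ∀ v → 1 ≤ f v → k ≤ f v
  labelled⇒≥k v fv≥1 with f v <? k
  ... | no  fv≮k = ≮⇒≥ fv≮k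
  ... | yes fv<k = begin
    k                   ≤⟨ m≤m+n k (AN v) ⟩
    k + AN v            ≤⟨ roman v fv<k ⟩
    f v + nbrSum G v f  ≡⟨ cong (f v +_) (nbrSum-of-labelled v fv≥1) ⟩
    f v + 0             ≡⟨ +-identityʳ (f v) ⟩
    f v                 ∎
    where open ≤-Reasoning

  label : ∀ v → Label k (f v)
  label v = toLabel (f v) (labelled⇒≥k v) (proj₁ krdf v)

  excessAround : V → ℕ
  excessAround y = nbrSum G y (λ x → excess (label x))

  received : V → ℕ
  received y = nbrSum G y (λ x → sent (label x))

  received≡ : ∀ y → received y ≡ suc k * excessAround y
  received≡ y = sym (*-distribˡ-nbrSum G y (suc k) (λ x → excess (label x)))

  charge : V → ℕ
  charge y = kept (label y) + received y

  Σcharge≤8*weight : Σᶠ N charge ≤ 8 * weight G f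
  Σcharge≤8*weight = begin
    Σᶠ N charge
      ≡⟨ Σᶠ-distrib-+ (λ y → kept (label y)) received ⟩
    Σᶠ N (λ y → kept (label y)) + Σᶠ N received
      ≡⟨ cong (Σᶠ N (λ y → kept (label y)) +_) (handshake G symmetric (λ x → sent (label x))) ⟩
    Σᶠ N (λ y → kept (label y)) + Σᶠ N (λ x → sent (label x) * degree G x)
      ≤⟨ +-monoʳ-≤ (Σᶠ N (λ y → kept (label y))) (Σᶠ-mono-≤ (λ x → *-monoʳ-≤ (sent (label x)) (Δ≤3 x))) ⟩
    Σᶠ N (λ y → kept (label y)) + Σᶠ N (λ x → sent (label x) * 3)
      ≡⟨ Σᶠ-distrib-+ (λ x → kept (label x)) (λ x → sent (label x) * 3) ⟨
    Σᶠ N (λ x → kept (label x) + sent (label x) * 3)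
      ≤⟨ Σᶠ-mono-≤ (λ x → kept+sent*3≤8*n 4≤k (label x)) ⟩
    Σᶠ N (λ x → 8 * f x)
      ≡⟨ *-distribˡ-Σᶠ 8 f ⟨
    8 * weight G f
      ∎
    where open ≤-Reasoning

  nbrSum-≤-excess : ∀ y → nbrSum G y f ≤ excessAround y + pred k * AN y
  nbrSum-≤-excess y = begin
    nbrSum G y f
      ≤⟨ nbrSum-mono-≤ G y (λ x → ≤-excess+pred*active (≤-trans (s≤s z≤n) 4≤k) (label x)) ⟩
    nbrSum G y (λ x → excess (label x) + pred k * active (f x))
      ≡⟨ nbrSum-distrib-+ G y (λ x → excess (label x)) (λ x → pred k * active (f x)) ⟩
    excessAround y + nbrSum G y (λ x → pred k * active (f x))
      ≡⟨ cong (excessAround y +_) (*-distribˡ-nbrSum G y (pred k) (λ x → active (f x))) ⟨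
    excessAround y + pred k * AN y
      ∎
    where open ≤-Reasoning

  excess-around-unlabelled : ∀ y → f y ≡ 0 → 2 ≤ excessAround y
  excess-around-unlabelled y fy≡0 with 2 ≤? AN y
  ... | yes 2≤AN = ≤-trans 2≤AN (nbrSum-mono-≤ G y (λ x → excess-≥-active (label x)))
  ... | no  2≰AN = cancel k (≤-pred (≰⇒> 2≰AN)) 4≤k (begin
    k + AN y                        ≤⟨ roman y (subst (_< k) (sym fy≡0) (≤-trans (s≤s z≤n) 4≤k)) ⟩
    f y + nbrSum G y f              ≡⟨ cong (_+ nbrSum G y f) fy≡0 ⟩
    nbrSum G y f                    ≤⟨ nbrSum-≤-excess y ⟩
    excessAround y + pred k * AN y  ∎)
    where
    open ≤-Reasoning
    cancel : ∀ k {a e} → a ≤ 1 → 4 ≤ k → k + a ≤ e + pred k * a → 2 ≤ e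
    cancel zero    _ () _
    cancel (suc k) {suc (suc a)} (s≤s ()) _ _
    cancel (suc k) {zero} {e} _ 4≤k k≤e = ≤-trans (≤-trans (s≤s (s≤s z≤n)) 4≤k)
      (subst₂ _≤_ (+-identityʳ (suc k)) (trans (cong (e +_) (*-zeroʳ k)) (+-identityʳ e)) k≤e)
    cancel (suc k) {suc zero} {e} _ _ k+1≤ = +-cancelʳ-≤ k 2 e
      (subst₂ _≤_ (+-comm (suc k) 1) (cong (e +_) (*-identityʳ k)) k+1≤)

  charge-≥ : ∀ y → 2 * suc k ≤ charge y
  charge-≥ y with f y ≟ 0
  ... | no  fy≢0 = ≤-trans (kept-≥ (label y) (n≢0⇒n>0 fy≢0)) (m≤m+n _ _)
  ... | yes fy≡0 = ≤-trans (begin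
    2 * suc k             ≡⟨ *-comm 2 (suc k) ⟩
    suc k * 2             ≤⟨ *-monoʳ-≤ (suc k) (excess-around-unlabelled y fy≡0) ⟩
    suc k * excessAround y ≡⟨ received≡ y ⟨
    received y            ∎) (m≤n+m _ (kept (label y)))
    where open ≤-Reasoning

  charge-weak : ∀ y → isWeak (label y) ≡ true → 2 * suc k + 7 ≤ charge y
  charge-weak y weak-y = ≤-trans (kept-weak (label y) weak-y) (m≤m+n _ _)

  charge-crowded : (∀ x → isWeak (label x) ≡ false) → ∀ y → 2 ≤ AN y → 2 * suc k + 7 ≤ charge y
  charge-crowded noWeak y 2≤AN = ≤-trans (begin
    2 * suc k + 7                 ≤⟨ +-monoʳ-≤ (2 * suc k) 7≤2[1+k] ⟩
    2 * suc k + 2 * suc k         ≡⟨ double (suc k) ⟩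
    suc k * (2 * 2)               ≤⟨ *-monoʳ-≤ (suc k) (*-monoʳ-≤ 2 2≤AN) ⟩
    suc k * (2 * AN y)            ≡⟨ cong (suc k *_) (*-distribˡ-nbrSum G y 2 (λ x → active (f x))) ⟩
    suc k * nbrSum G y (λ x → 2 * active (f x))
      ≤⟨ *-monoʳ-≤ (suc k) (nbrSum-mono-≤ G y (λ x → excess-≥-2*active (label x) (noWeak x))) ⟩
    suc k * excessAround y        ≡⟨ received≡ y ⟨
    received y                    ∎) (m≤n+m _ (kept (label y)))
    where
    open ≤-Reasoning
    7≤2[1+k] : 7 ≤ 2 * suc k
    7≤2[1+k] = ≤-trans (n≤1+n 7) (*-monoʳ-≤ 2 (≤-trans 4≤k (n≤1+n k)))
    double : ∀ a → 2 * a + 2 * a ≡ a * (2 * 2)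
    double = solve-∀

  surplus⇒weight-bound : ∀ y → 2 * suc k + 7 ≤ charge y → (k + 1) * N + 4 ≤ 4 * weight G f
  surplus⇒weight-bound y surplus = 2*a+7≤2*b⇒a+4≤b ((k + 1) * N) (4 * weight G f) (begin
    2 * ((k + 1) * N) + 7  ≡⟨ cong (_+ 7) (rearrange k N) ⟩
    N * (2 * suc k) + 7    ≤⟨ Σᶠ-≥-with-surplus (2 * suc k) 7 y charge-≥ surplus ⟩
    Σᶠ N charge            ≤⟨ Σcharge≤8*weight ⟩
    8 * weight G f         ≡⟨ *-assoc 2 4 (weight G f) ⟩
    2 * (4 * weight G f)   ∎)
    where
    open ≤-Reasoning
    rearrange : ∀ k n → 2 * ((k + 1) * n) ≡ n * (2 * suc k)
    rearrange = solve-∀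

  perfect-code-or-weight-bound : (∀ y → AN y ≤ 1) ⊎ (k + 1) * N + 4 ≤ 4 * weight G f
  perfect-code-or-weight-bound with Fin.any? (λ x → isWeak (label x) Bool.≟ true)
  ... | yes (x , weak-x) = inj₂ (surplus⇒weight-bound x (charge-weak x weak-x))
  ... | no  noWeak with Fin.any? (λ y → 2 ≤? AN y)
  ...   | yes (y , 2≤AN) = inj₂ (surplus⇒weight-bound y (charge-crowded notWeak y 2≤AN))
    where
    notWeak : ∀ x → isWeak (label x) ≡ false
    notWeak x = ¬-not (λ weak-x → noWeak (x , weak-x))
  ...   | no  noCrowded  = inj₁ (λ y → ≤-pred (≰⇒> (λ 2≤AN → noCrowded (y , 2≤AN))))

support-perfectCode : ∀ {G k f} → 1 ≤ k → IsKRDF k G f → PositiveIndependent G f →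
                      (∀ y → activeNbrs G f y ≤ 1) → PerfectCode G (λ v → 1 ≤ f v)
support-perfectCode {G} {k} {f} 1≤k krdf indep AN≤1 = record
  { independent = indep
  ; dominating  = dominating
  ; uniquely    = uniquely
  }
  where
  unlabelled : ∀ {v} → ¬ 1 ≤ f v → f v ≡ 0
  unlabelled ¬fv≥1 = n<1⇒n≡0 (≰⇒> ¬fv≥1)

  dominating : ∀ v → ¬ 1 ≤ f v → ∃[ w ] Adj G v w × 1 ≤ f w
  dominating v ¬fv≥1 = nbrSum-positive G v f (begin
    1                              ≤⟨ 1≤k ⟩
    k                              ≤⟨ m≤m+n k (activeNbrs G f v) ⟩
    k + activeNbrs G f v           ≤⟨ proj₂ krdf v (subst (_< k) (sym (unlabelled ¬fv≥1)) 1≤k) ⟩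
    f v + nbrSum G v f             ≡⟨ cong (_+ nbrSum G v f) (unlabelled ¬fv≥1) ⟩
    nbrSum G v f                   ∎)
    where open ≤-Reasoning

  uniquely : ∀ v w w′ → ¬ 1 ≤ f v → Adj G v w → Adj G v w′ → 1 ≤ f w → 1 ≤ f w′ → w ≡ w′
  uniquely v w w′ _ v~w v~w′ fw≥1 fw′≥1 with w Fin.≟ w′
  ... | yes w≡w′ = w≡w′
  ... | no  w≢w′ = ⊥-elim (<⇒≱ (s≤s (AN≤1 v))
    (nbrSum-≥-length G v (w ∷ w′ ∷ []) ((w≢w′ ∷ []) ∷ [] ∷ [])
                     ((v~w , active-positive fw≥1) ∷ (v~w′ , active-positive fw′≥1) ∷ [])))

-- Graphs given by edge lists

endpoints : List Edge → List ℕ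
endpoints []             = []
endpoints ((a , b) ∷ es) = a ∷ b ∷ endpoints es

multiplicity : ℕ → List ℕ → ℕ
multiplicity x []       = 0
multiplicity x (a ∷ as) = 𝟙 (a ≡ᵇ x) + multiplicity x as

endpoints-++ : ∀ es fs → endpoints (es ++ fs) ≡ endpoints es ++ endpoints fs
endpoints-++ []             fs = refl
endpoints-++ ((a , b) ∷ es) fs = cong (λ xs → a ∷ b ∷ xs) (endpoints-++ es fs)

multiplicity-++ : ∀ x as bs → multiplicity x (as ++ bs) ≡ multiplicity x as + multiplicity x bs
multiplicity-++ x []       bs = refl
multiplicity-++ x (a ∷ as) bs = trans (cong (𝟙 (a ≡ᵇ x) +_) (multiplicity-++ x as bs)) (sym (+-assoc (𝟙 (a ≡ᵇ x)) _ _))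

occurrences : ℕ → List Edge → ℕ
occurrences x es = multiplicity x (endpoints es)

occurrences-++ : ∀ x es fs → occurrences x (es ++ fs) ≡ occurrences x es + occurrences x fs
occurrences-++ x es fs = trans (cong (multiplicity x) (endpoints-++ es fs)) (multiplicity-++ x (endpoints es) (endpoints fs))

occurrences-concatMap : ∀ x {n} {A : Set} (g : A → List Edge) (h : Fin n → A) →
                        occurrences x (concatMap g (tabulate h)) ≡ Σᶠ n (λ i → occurrences x (g (h i)))
occurrences-concatMap x {zero}  g h = refl
occurrences-concatMap x {suc n} g h =
  trans (occurrences-++ x (g (h zero)) _) (cong (occurrences x (g (h zero)) +_) (occurrences-concatMap x g (h ∘ suc)))

edgeBetween-sym : ∀ x y e → edgeBetween x y e ≡ edgeBetween y x e
edgeBetween-sym x y (a , b) = ∨-comm ((a ≡ᵇ x) ∧ (b ≡ᵇ y)) ((a ≡ᵇ y) ∧ (b ≡ᵇ x))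

edgeBetween-self : ∀ x y → T (edgeBetween x y (x , y))
edgeBetween-self x y = Equivalence.from T-∨ (inj₁ (Equivalence.from T-∧ (≡⇒≡ᵇ x x refl , ≡⇒≡ᵇ y y refl)))

Σᶠ-*𝟙≡ᵇ≤ : ∀ n c a → Σᶠ n (λ y → c * 𝟙 (a ≡ᵇ toℕ y)) ≤ c
Σᶠ-*𝟙≡ᵇ≤ n c a = Σᶠ-*𝟙-≤ c (λ (y : Fin n) → a ≡ᵇ toℕ y)
  (λ i j a≡i a≡j → Fin.toℕ-injective (trans (sym (≡ᵇ⇒≡ a _ a≡i)) (≡ᵇ⇒≡ a _ a≡j)))

neighbours-≤-occurrences : ∀ n X (es : List Edge) →
  Σᶠ n (λ y → 𝟙 (any (edgeBetween X (toℕ y)) es)) ≤ occurrences X es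
neighbours-≤-occurrences n X [] = ≤-reflexive (Σᶠ-zero {n} (λ _ → refl))
neighbours-≤-occurrences n X ((a , b) ∷ es) = begin
  Σᶠ n (λ y → 𝟙 (edgeBetween X (toℕ y) (a , b) ∨ any (edgeBetween X (toℕ y)) es))
    ≤⟨ Σᶠ-mono-≤ {n} (λ y → 𝟙-∨ (edgeBetween X (toℕ y) (a , b)) (any (edgeBetween X (toℕ y)) es)) ⟩
  Σᶠ n (λ y → 𝟙 (edgeBetween X (toℕ y) (a , b)) + 𝟙 (any (edgeBetween X (toℕ y)) es))
    ≡⟨ Σᶠ-distrib-+ {n} (λ y → 𝟙 (edgeBetween X (toℕ y) (a , b))) (λ y → 𝟙 (any (edgeBetween X (toℕ y)) es)) ⟩
  Σᶠ n (λ y → 𝟙 (edgeBetween X (toℕ y) (a , b))) + Σᶠ n (λ y → 𝟙 (any (edgeBetween X (toℕ y)) es))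
    ≤⟨ +-mono-≤ edge (neighbours-≤-occurrences n X es) ⟩
  𝟙 (a ≡ᵇ X) + 𝟙 (b ≡ᵇ X) + occurrences X es
    ≡⟨ +-assoc (𝟙 (a ≡ᵇ X)) _ _ ⟩
  occurrences X ((a , b) ∷ es)
    ∎
  where
  open ≤-Reasoning
  edge : Σᶠ n (λ y → 𝟙 (edgeBetween X (toℕ y) (a , b))) ≤ 𝟙 (a ≡ᵇ X) + 𝟙 (b ≡ᵇ X)
  edge = begin
    Σᶠ n (λ y → 𝟙 (edgeBetween X (toℕ y) (a , b)))
      ≤⟨ Σᶠ-mono-≤ {n} (λ y → 𝟙-∨ ((a ≡ᵇ X) ∧ (b ≡ᵇ toℕ y)) ((a ≡ᵇ toℕ y) ∧ (b ≡ᵇ X))) ⟩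
    Σᶠ n (λ y → 𝟙 ((a ≡ᵇ X) ∧ (b ≡ᵇ toℕ y)) + 𝟙 ((a ≡ᵇ toℕ y) ∧ (b ≡ᵇ X)))
      ≡⟨ Σᶠ-cong {n} (λ y → cong₂ _+_ (𝟙-∧ (a ≡ᵇ X) (b ≡ᵇ toℕ y))
                                      (trans (𝟙-∧ (a ≡ᵇ toℕ y) (b ≡ᵇ X)) (*-comm _ (𝟙 (b ≡ᵇ X))))) ⟩
    Σᶠ n (λ y → 𝟙 (a ≡ᵇ X) * 𝟙 (b ≡ᵇ toℕ y) + 𝟙 (b ≡ᵇ X) * 𝟙 (a ≡ᵇ toℕ y))
      ≡⟨ Σᶠ-distrib-+ {n} (λ y → 𝟙 (a ≡ᵇ X) * 𝟙 (b ≡ᵇ toℕ y))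
                          (λ y → 𝟙 (b ≡ᵇ X) * 𝟙 (a ≡ᵇ toℕ y)) ⟩
    Σᶠ n (λ y → 𝟙 (a ≡ᵇ X) * 𝟙 (b ≡ᵇ toℕ y)) + Σᶠ n (λ y → 𝟙 (b ≡ᵇ X) * 𝟙 (a ≡ᵇ toℕ y))
      ≤⟨ +-mono-≤ (Σᶠ-*𝟙≡ᵇ≤ n (𝟙 (a ≡ᵇ X)) b) (Σᶠ-*𝟙≡ᵇ≤ n (𝟙 (b ≡ᵇ X)) a) ⟩
    𝟙 (a ≡ᵇ X) + 𝟙 (b ≡ᵇ X)
      ∎

-- Positions 7 i + c and residues modulo ℓ

≡ᵇ-refl : ∀ n → (n ≡ᵇ n) ≡ true
≡ᵇ-refl n = dec-true (n ≟ n) refl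

≢⇒≡ᵇ-false : ∀ {m n} → m ≢ n → (m ≡ᵇ n) ≡ false
≢⇒≡ᵇ-false {m} {n} = dec-false (m ≟ n)

≡ᵇ-cancelˡ : ∀ n {m x} → (n + m ≡ᵇ n + x) ≡ (m ≡ᵇ x)
≡ᵇ-cancelˡ zero    = refl
≡ᵇ-cancelˡ (suc n) = ≡ᵇ-cancelˡ n

block-bound : ∀ {i j c} → c < 7 → i < j → 7 * i + c < 7 * j
block-bound {i} {j} {c} c<7 i<j = begin-strict
  7 * i + c  <⟨ +-monoʳ-< (7 * i) c<7 ⟩
  7 * i + 7  ≡⟨ +-comm (7 * i) 7 ⟩
  7 + 7 * i  ≡⟨ *-suc 7 i ⟨
  7 * suc i  ≤⟨ *-monoʳ-≤ 7 i<j ⟩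
  7 * j      ∎
  where open ≤-Reasoning

block-injective : ∀ {i j c d} → c < 7 → d < 7 → 7 * i + c ≡ 7 * j + d → i ≡ j × c ≡ d
block-injective {i} {j} {c} {d} c<7 d<7 eq with <-cmp i j
... | tri< i<j _ _ = ⊥-elim (<⇒≱ (block-bound c<7 i<j) (≤-trans (m≤m+n (7 * j) d) (≤-reflexive (sym eq))))
... | tri> _ _ j<i = ⊥-elim (<⇒≱ (block-bound d<7 j<i) (≤-trans (m≤m+n (7 * i) c) (≤-reflexive eq)))
... | tri≈ _ refl _ = refl , +-cancelˡ-≡ (7 * i) c d eq

≡ᵇ-block : ∀ i j {c d} → c < 7 → d < 7 → (7 * i + c ≡ᵇ 7 * j + d) ≡ (i ≡ᵇ j) ∧ (c ≡ᵇ d)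
≡ᵇ-block i j {c} {d} c<7 d<7 with i ≟ j | c ≟ d
... | yes refl | yes refl rewrite ≡ᵇ-refl i | ≡ᵇ-refl c = ≡ᵇ-refl (7 * i + c)
... | yes refl | no  c≢d  rewrite ≡ᵇ-refl i | ≢⇒≡ᵇ-false c≢d =
  ≢⇒≡ᵇ-false {7 * i + c} (λ eq → c≢d (proj₂ (block-injective {i} {i} c<7 d<7 eq)))
... | no  i≢j  | _        rewrite ≢⇒≡ᵇ-false i≢j =
  ≢⇒≡ᵇ-false {7 * i + c} (λ eq → i≢j (proj₁ (block-injective {i} {j} c<7 d<7 eq)))

module _ (ℓ : ℕ) .{{_ : NonZero ℓ}} where

  +-%-reduceˡ : ∀ b {d} → d < ℓ → (b + d) % ℓ ≡ (b % ℓ + d) % ℓ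
  +-%-reduceˡ b {d} d<ℓ = trans (%-distribˡ-+ b d ℓ) (cong (λ x → (b % ℓ + x) % ℓ) (m<n⇒m%n≡m d<ℓ))

  %-shift-≢ : ∀ b {d} → 0 < d → d < ℓ → (b + d) % ℓ ≢ b % ℓ
  %-shift-≢ b {d} 0<d d<ℓ eq with b % ℓ + d <? ℓ
  ... | yes r+d<ℓ = <⇒≢ (m<m+n (b % ℓ) 0<d) (sym (begin
    b % ℓ + d            ≡⟨ m<n⇒m%n≡m r+d<ℓ ⟨
    (b % ℓ + d) % ℓ      ≡⟨ +-%-reduceˡ b d<ℓ ⟨
    (b + d) % ℓ          ≡⟨ eq ⟩
    b % ℓ                ∎))
    where open ≡-Reasoning
  ... | no  r+d≮ℓ = <⇒≢ d<ℓ (+-cancelˡ-≡ (b % ℓ) d ℓ (begin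
    b % ℓ + d                 ≡⟨ m∸n+n≡m ℓ≤r+d ⟨
    (b % ℓ + d ∸ ℓ) + ℓ       ≡⟨ cong (_+ ℓ) wrapped ⟩
    b % ℓ + ℓ                 ∎))
    where
    open ≡-Reasoning
    ℓ≤r+d : ℓ ≤ b % ℓ + d
    ℓ≤r+d = ≮⇒≥ r+d≮ℓ
    r+d∸ℓ<ℓ : b % ℓ + d ∸ ℓ < ℓ
    r+d∸ℓ<ℓ = ≤-trans (∸-monoˡ-< (+-mono-< (m%n<n b ℓ) d<ℓ) ℓ≤r+d) (≤-reflexive (m+n∸m≡n ℓ ℓ))
    wrapped : b % ℓ + d ∸ ℓ ≡ b % ℓ
    wrapped = begin
      b % ℓ + d ∸ ℓ          ≡⟨ m<n⇒m%n≡m r+d∸ℓ<ℓ ⟨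
      (b % ℓ + d ∸ ℓ) % ℓ    ≡⟨ m≤n⇒[n∸m]%m≡n%m ℓ≤r+d ⟩
      (b % ℓ + d) % ℓ        ≡⟨ +-%-reduceˡ b d<ℓ ⟨
      (b + d) % ℓ            ≡⟨ eq ⟩
      b % ℓ                  ∎

  %-distinct : ∀ a {p q} → p < q → q < ℓ → (a + p) % ℓ ≢ (a + q) % ℓ
  %-distinct a {p} {q} p<q q<ℓ eq =
    %-shift-≢ (a + p) (m<n⇒0<n∸m p<q) (≤-trans (s≤s (m∸n≤m q p)) q<ℓ) (trans (cong (_% ℓ) shifted) (sym eq))
    where
    shifted : a + p + (q ∸ p) ≡ a + q
    shifted = trans (+-assoc a p (q ∸ p)) (cong (a +_) (m+[n∸m]≡n (<⇒≤ p<q)))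

  +-%-injective : ∀ a {p q} → p < ℓ → q < ℓ → (a + p) % ℓ ≡ (a + q) % ℓ → p ≡ q
  +-%-injective a {p} {q} p<ℓ q<ℓ eq with <-cmp p q
  ... | tri≈ _ p≡q _ = p≡q
  ... | tri< p<q _ _ = ⊥-elim (%-distinct a p<q q<ℓ eq)
  ... | tri> _ _ q<p = ⊥-elim (%-distinct a q<p p<ℓ (sym eq))

-- The ℓ-LP₀-snark

-- Defined by cases so that vertexℕ i 0 is literally pV i = 7 * i: then endpoints (blockEdges i)
-- is map (vertexℕ i) blockOffsets by computation.
vertexℕ : ℕ → ℕ → ℕ
vertexℕ i zero    = 7 * i
vertexℕ i (suc d) = 7 * i + suc d

vertexℕ≡ : ∀ i d → vertexℕ i d ≡ 7 * i + d
vertexℕ≡ i zero    = sym (+-identityʳ (7 * i))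
vertexℕ≡ i (suc d) = refl

multiplicity-vertexℕ : ∀ i j {c} ds → c < 7 → All (_< 7) ds →
                       multiplicity (7 * j + c) (map (vertexℕ i) ds) ≡ 𝟙 (i ≡ᵇ j) * multiplicity c ds
multiplicity-vertexℕ i j []       c<7 []           = sym (*-zeroʳ (𝟙 (i ≡ᵇ j)))
multiplicity-vertexℕ i j {c} (d ∷ ds) c<7 (d<7 ∷ ds<7) = begin
  𝟙 (vertexℕ i d ≡ᵇ 7 * j + c) + multiplicity (7 * j + c) (map (vertexℕ i) ds)
    ≡⟨ cong₂ _+_ (cong (λ x → 𝟙 (x ≡ᵇ 7 * j + c)) (vertexℕ≡ i d)) (multiplicity-vertexℕ i j ds c<7 ds<7) ⟩
  𝟙 (7 * i + d ≡ᵇ 7 * j + c) + 𝟙 (i ≡ᵇ j) * multiplicity c ds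
    ≡⟨ cong (_+ 𝟙 (i ≡ᵇ j) * multiplicity c ds)
            (trans (cong 𝟙 (≡ᵇ-block i j d<7 c<7)) (𝟙-∧ (i ≡ᵇ j) (d ≡ᵇ c))) ⟩
  𝟙 (i ≡ᵇ j) * 𝟙 (d ≡ᵇ c) + 𝟙 (i ≡ᵇ j) * multiplicity c ds
    ≡⟨ *-distribˡ-+ (𝟙 (i ≡ᵇ j)) (𝟙 (d ≡ᵇ c)) (multiplicity c ds) ⟨
  𝟙 (i ≡ᵇ j) * multiplicity c (d ∷ ds)
    ∎
  where open ≡-Reasoning

-- The offsets of the 16 endpoints of blockEdges i, and of the endpoints s_i, v_i and
-- r_{i+1}, u_{i+1} of the two edges joining B_i to B_{i+1}, whichever pair is chosen.
blockOffsets outOffsets inOffsets : List ℕ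
blockOffsets = 0 ∷ 4 ∷ 4 ∷ 1 ∷ 1 ∷ 2 ∷ 2 ∷ 3 ∷ 3 ∷ 0 ∷ 5 ∷ 6 ∷ 5 ∷ 0 ∷ 6 ∷ 1 ∷ []
outOffsets   = 3 ∷ 6 ∷ []
inOffsets    = 2 ∷ 5 ∷ []

blockDegree outDegree inDegree : ℕ → ℕ
blockDegree c = multiplicity c blockOffsets
outDegree   c = multiplicity c outOffsets
inDegree    c = multiplicity c inOffsets

offsets-table : ∀ c → c < 7 → blockDegree c + outDegree c + inDegree c + 𝟙 (4 ≡ᵇ c) ≤ 3
offsets-table 0 _ = ≤-refl
offsets-table 1 _ = ≤-refl
offsets-table 2 _ = ≤-refl
offsets-table 3 _ = ≤-refl
offsets-table 4 _ = ≤-refl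
offsets-table 5 _ = ≤-refl
offsets-table 6 _ = ≤-refl
offsets-table (suc (suc (suc (suc (suc (suc (suc _))))))) (s≤s (s≤s (s≤s (s≤s (s≤s (s≤s (s≤s ())))))))

module LP₀ (l : ℕ) (conn : Fin (2 + l) → Bool) (offset : ℕ) (blocks : List Bool) where

  ℓ : ℕ
  ℓ = 2 + l

  G : Graph
  G = LP0Snark ℓ conn offset blocks

  E links : List Edge
  E     = snarkEdges ℓ conn offset blocks
  links = linkEdges ℓ offset 0 blocks

  blockAndConn : Fin ℓ → List Edge
  blockAndConn i = blockEdges (toℕ i) ++ connEdges ℓ (conn i) (toℕ i)

  next : ℕ → ℕ
  next i = suc i % ℓ

  occurrences-E : ∀ X → occurrences X E ≡ Σᶠ ℓ (λ i → occurrences X (blockAndConn i)) + occurrences X links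
  occurrences-E X = trans (occurrences-++ X (concatMap blockAndConn (allFin ℓ)) links)
                          (cong (_+ occurrences X links) (occurrences-concatMap X blockAndConn id))

  occurrences-conn : ∀ X b i → occurrences X (connEdges ℓ b i) ≡
                     multiplicity X (map (vertexℕ i) outOffsets) + multiplicity X (map (vertexℕ (next i)) inOffsets)
  occurrences-conn X true  i =
    swap-middle (𝟙 (sV i ≡ᵇ X)) (𝟙 (rV (next i) ≡ᵇ X)) (𝟙 (vV i ≡ᵇ X)) (𝟙 (uV (next i) ≡ᵇ X))
    where
    swap-middle : ∀ a b c d → a + (b + (c + (d + 0))) ≡ (a + (c + 0)) + (b + (d + 0))
    swap-middle = solve-∀
  occurrences-conn X false i =
    rotate (𝟙 (sV i ≡ᵇ X)) (𝟙 (uV (next i) ≡ᵇ X)) (𝟙 (vV i ≡ᵇ X)) (𝟙 (rV (next i) ≡ᵇ X))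
    where
    rotate : ∀ a b c d → a + (b + (c + (d + 0))) ≡ (a + (c + 0)) + (d + (b + 0))
    rotate = solve-∀

  occurrences-blockAndConn : ∀ j {c} → c < 7 → ∀ i → occurrences (7 * j + c) (blockAndConn i) ≡
    (blockDegree c + outDegree c) * 𝟙 (toℕ i ≡ᵇ j) + inDegree c * 𝟙 (next (toℕ i) ≡ᵇ j)
  occurrences-blockAndConn j {c} c<7 i = begin
    occurrences X (blockAndConn i)
      ≡⟨ occurrences-++ X (blockEdges (toℕ i)) (connEdges ℓ (conn i) (toℕ i)) ⟩
    occurrences X (blockEdges (toℕ i)) + occurrences X (connEdges ℓ (conn i) (toℕ i))
      ≡⟨ cong (occurrences X (blockEdges (toℕ i)) +_) (occurrences-conn X (conn i) (toℕ i)) ⟩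
    multiplicity X (map (vertexℕ (toℕ i)) blockOffsets) + (multiplicity X (map (vertexℕ (toℕ i)) outOffsets)
                                                          + multiplicity X (map (vertexℕ (next (toℕ i))) inOffsets))
      ≡⟨ cong₂ _+_ (multiplicity-vertexℕ (toℕ i) j blockOffsets c<7 (from-yes (All.all? (_<? 7) blockOffsets)))
                   (cong₂ _+_ (multiplicity-vertexℕ (toℕ i) j outOffsets c<7 (from-yes (All.all? (_<? 7) outOffsets)))
                              (multiplicity-vertexℕ (next (toℕ i)) j inOffsets c<7 (from-yes (All.all? (_<? 7) inOffsets)))) ⟩
    a * blockDegree c + (a * outDegree c + b * inDegree c)
      ≡⟨ collect a b (blockDegree c) (outDegree c) (inDegree c) ⟩
    (blockDegree c + outDegree c) * a + inDegree c * b
      ∎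
    where
    open ≡-Reasoning
    X : ℕ
    X = 7 * j + c
    a b : ℕ
    a = 𝟙 (toℕ i ≡ᵇ j)
    b = 𝟙 (next (toℕ i) ≡ᵇ j)
    collect : ∀ a b x y z → a * x + (a * y + b * z) ≡ (x + y) * a + z * b
    collect = solve-∀

  occurrences-blocks-≤ : ∀ j {c} → c < 7 →
                         Σᶠ ℓ (λ i → occurrences (7 * j + c) (blockAndConn i)) ≤ blockDegree c + outDegree c + inDegree c
  occurrences-blocks-≤ j {c} c<7 = begin
    Σᶠ ℓ (λ i → occurrences (7 * j + c) (blockAndConn i))
      ≡⟨ Σᶠ-cong {ℓ} (occurrences-blockAndConn j c<7) ⟩
    Σᶠ ℓ (λ i → K₀₁ * 𝟙 (toℕ i ≡ᵇ j) + inDegree c * 𝟙 (next (toℕ i) ≡ᵇ j))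
      ≡⟨ Σᶠ-distrib-+ {ℓ} (λ i → K₀₁ * 𝟙 (toℕ i ≡ᵇ j)) (λ i → inDegree c * 𝟙 (next (toℕ i) ≡ᵇ j)) ⟩
    Σᶠ ℓ (λ i → K₀₁ * 𝟙 (toℕ i ≡ᵇ j)) + Σᶠ ℓ (λ i → inDegree c * 𝟙 (next (toℕ i) ≡ᵇ j))
      ≤⟨ +-mono-≤ (Σᶠ-*𝟙-≤ {ℓ} K₀₁ (λ i → toℕ i ≡ᵇ j) same-block)
                  (Σᶠ-*𝟙-≤ {ℓ} (inDegree c) (λ i → next (toℕ i) ≡ᵇ j) same-next) ⟩
    K₀₁ + inDegree c
      ∎
    where
    open ≤-Reasoning
    K₀₁ : ℕ
    K₀₁ = blockDegree c + outDegree c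
    same-block : ∀ i i′ → T (toℕ i ≡ᵇ j) → T (toℕ i′ ≡ᵇ j) → i ≡ i′
    same-block i i′ i≡j i′≡j = Fin.toℕ-injective (trans (≡ᵇ⇒≡ _ j i≡j) (sym (≡ᵇ⇒≡ _ j i′≡j)))
    same-next : ∀ i i′ → T (next (toℕ i) ≡ᵇ j) → T (next (toℕ i′) ≡ᵇ j) → i ≡ i′
    same-next i i′ i≡j i′≡j = Fin.toℕ-injective
      (+-%-injective ℓ 1 (Fin.toℕ<n i) (Fin.toℕ<n i′) (trans (≡ᵇ⇒≡ _ j i≡j) (sym (≡ᵇ⇒≡ _ j i′≡j))))

  occurrences-blocks-beyond : ∀ j {c} → c < 7 → ℓ ≤ j → Σᶠ ℓ (λ i → occurrences (7 * j + c) (blockAndConn i)) ≡ 0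
  occurrences-blocks-beyond j {c} c<7 ℓ≤j = Σᶠ-zero {ℓ} (λ i → begin
    occurrences (7 * j + c) (blockAndConn i)
      ≡⟨ occurrences-blockAndConn j c<7 i ⟩
    K₀₁ * 𝟙 (toℕ i ≡ᵇ j) + inDegree c * 𝟙 (next (toℕ i) ≡ᵇ j)
      ≡⟨ cong₂ (λ x y → K₀₁ * 𝟙 x + inDegree c * 𝟙 y) (beyond (Fin.toℕ<n i))
                                                      (beyond (m%n<n (suc (toℕ i)) ℓ)) ⟩
    K₀₁ * 0 + inDegree c * 0
      ≡⟨ cong₂ _+_ (*-zeroʳ K₀₁) (*-zeroʳ (inDegree c)) ⟩
    0 ∎)
    where
    open ≡-Reasoning
    K₀₁ : ℕ
    K₀₁ = blockDegree c + outDegree c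
    beyond : ∀ {x} → x < ℓ → (x ≡ᵇ j) ≡ false
    beyond {x} x<ℓ = ≢⇒≡ᵇ-false {x} (<⇒≢ (<-≤-trans x<ℓ ℓ≤j))

  tMod<7ℓ : ∀ p → tMod ℓ p < 7 * ℓ
  tMod<7ℓ p = block-bound (s≤s (s≤s (s≤s (s≤s (s≤s z≤n))))) (m%n<n p ℓ)

  link-vertex-above : ∀ {X} → X < 7 * ℓ → ∀ m → (7 * ℓ + m ≡ᵇ X) ≡ false
  link-vertex-above X<7ℓ m =
    ≢⇒≡ᵇ-false {7 * ℓ + m} (λ eq → <⇒≱ X<7ℓ (≤-trans (m≤m+n (7 * ℓ) m) (≤-reflexive eq)))

  occurrences-links-below : ∀ {X} → X < 7 * ℓ → ∀ a m bs →
    occurrences X (linkEdges ℓ a m bs) ≡ Σᶠ (totalSize bs) (λ p → 𝟙 (tMod ℓ (a + toℕ p) ≡ᵇ X))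
  occurrences-links-below X<7ℓ a m [] = refl
  occurrences-links-below {X} X<7ℓ a m (true ∷ bs) rewrite link-vertex-above X<7ℓ m =
    cong₂ _+_ (cong t-hit (sym (+-identityʳ a))) (cong (t-hit (a + 1) +_) (cong (t-hit (a + 2) +_)
      (trans (occurrences-links-below X<7ℓ (a + 3) (suc m) bs)
             (Σᶠ-cong {totalSize bs} (λ p → cong t-hit (+-assoc a 3 (toℕ p)))))))
    where
    t-hit : ℕ → ℕ
    t-hit y = 𝟙 (tMod ℓ y ≡ᵇ X)
  occurrences-links-below {X} X<7ℓ a m (false ∷ bs) =
    cong₂ _+_ (cong t-hit (sym (+-identityʳ a))) (cong (t-hit (a + 1) +_)
      (trans (occurrences-links-below X<7ℓ (a + 2) m bs)
             (Σᶠ-cong {totalSize bs} (λ p → cong t-hit (+-assoc a 2 (toℕ p))))))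
    where
    t-hit : ℕ → ℕ
    t-hit y = 𝟙 (tMod ℓ y ≡ᵇ X)

  occurrences-links-≤ : totalSize blocks ≡ ℓ → ∀ j {c} → c < 7 → 7 * j + c < 7 * ℓ →
                        occurrences (7 * j + c) links ≤ 𝟙 (4 ≡ᵇ c)
  occurrences-links-≤ size j {c} c<7 X<7ℓ = begin
    occurrences (7 * j + c) links
      ≡⟨ occurrences-links-below X<7ℓ offset 0 blocks ⟩
    Σᶠ L (λ p → 𝟙 (tMod ℓ (offset + toℕ p) ≡ᵇ 7 * j + c))
      ≡⟨ Σᶠ-cong {L} (λ p → factor (offset + toℕ p)) ⟩
    Σᶠ L (λ p → 𝟙 (4 ≡ᵇ c) * 𝟙 ((offset + toℕ p) % ℓ ≡ᵇ j))
      ≤⟨ Σᶠ-*𝟙-≤ (𝟙 (4 ≡ᵇ c)) (λ p → (offset + toℕ p) % ℓ ≡ᵇ j) same-position ⟩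
    𝟙 (4 ≡ᵇ c)
      ∎
    where
    open ≤-Reasoning
    L : ℕ
    L = totalSize blocks
    factor : ∀ y → 𝟙 (tMod ℓ y ≡ᵇ 7 * j + c) ≡ 𝟙 (4 ≡ᵇ c) * 𝟙 (y % ℓ ≡ᵇ j)
    factor y = trans (cong 𝟙 (≡ᵇ-block (y % ℓ) j (s≤s (s≤s (s≤s (s≤s (s≤s z≤n))))) c<7))
                     (trans (𝟙-∧ (y % ℓ ≡ᵇ j) (4 ≡ᵇ c)) (*-comm (𝟙 (y % ℓ ≡ᵇ j)) (𝟙 (4 ≡ᵇ c))))
    within : ∀ (p : Fin L) → toℕ p < ℓ
    within p = subst (toℕ p <_) size (Fin.toℕ<n p)
    same-position : ∀ p q → T ((offset + toℕ p) % ℓ ≡ᵇ j) → T ((offset + toℕ q) % ℓ ≡ᵇ j) → p ≡ q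
    same-position p q p≡j q≡j = Fin.toℕ-injective
      (+-%-injective ℓ offset (within p) (within q) (trans (≡ᵇ⇒≡ _ j p≡j) (sym (≡ᵇ⇒≡ _ j q≡j))))

  module _ (x : ℕ) where

    private
      t-below : ∀ p → (tMod ℓ p ≡ᵇ 7 * ℓ + x) ≡ false
      t-below p = ≢⇒≡ᵇ-false {tMod ℓ p} (<⇒≢ (≤-trans (tMod<7ℓ p) (m≤m+n (7 * ℓ) x)))

    occurrences-links-after : ∀ {m} → x < m → ∀ a bs → occurrences (7 * ℓ + x) (linkEdges ℓ a m bs) ≡ 0
    occurrences-links-after x<m a [] = refl
    occurrences-links-after {m} x<m a (true ∷ bs)
      rewrite t-below a | t-below (a + 1) | t-below (a + 2) | ≡ᵇ-cancelˡ (7 * ℓ) {m} {x}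
            | ≢⇒≡ᵇ-false {m} (≢-sym (<⇒≢ x<m)) = occurrences-links-after (m<n⇒m<1+n x<m) (a + 3) bs
    occurrences-links-after x<m a (false ∷ bs)
      rewrite t-below a | t-below (a + 1) = occurrences-links-after x<m (a + 2) bs

    occurrences-links-above : ∀ a m bs → occurrences (7 * ℓ + x) (linkEdges ℓ a m bs) ≤ 3
    occurrences-links-above a m [] = z≤n
    occurrences-links-above a m (true ∷ bs)
      rewrite t-below a | t-below (a + 1) | t-below (a + 2) | ≡ᵇ-cancelˡ (7 * ℓ) {m} {x} with m ≟ x
    ... | yes refl rewrite ≡ᵇ-refl m | occurrences-links-after (n<1+n m) (a + 3) bs = ≤-refl
    ... | no  m≢x  rewrite ≢⇒≡ᵇ-false m≢x = occurrences-links-above (a + 3) (suc m) bs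
    occurrences-links-above a m (false ∷ bs)
      rewrite t-below a | t-below (a + 1) = occurrences-links-above (a + 2) m bs

  occurrences-≤3 : totalSize blocks ≡ ℓ → ∀ X → occurrences X E ≤ 3
  occurrences-≤3 size X = subst (λ Y → occurrences Y E ≤ 3) (sym X≡7j+c) (at (X / 7) (m%n<n X 7))
    where
    X≡7j+c : X ≡ 7 * (X / 7) + X % 7
    X≡7j+c = trans (m≡m%n+[m/n]*n X 7) (trans (+-comm (X % 7) _) (cong (_+ X % 7) (*-comm (X / 7) 7)))
    at : ∀ j {c} → c < 7 → occurrences (7 * j + c) E ≤ 3
    at j {c} c<7 with 7 * j + c <? 7 * ℓ
    ... | yes below = begin
      occurrences (7 * j + c) E
        ≡⟨ occurrences-E (7 * j + c) ⟩
      Σᶠ ℓ (λ i → occurrences (7 * j + c) (blockAndConn i)) + occurrences (7 * j + c) links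
        ≤⟨ +-mono-≤ (occurrences-blocks-≤ j c<7) (occurrences-links-≤ size j c<7 below) ⟩
      blockDegree c + outDegree c + inDegree c + 𝟙 (4 ≡ᵇ c)
        ≤⟨ offsets-table c c<7 ⟩
      3 ∎
      where open ≤-Reasoning
    ... | no  above = begin
      occurrences (7 * j + c) E
        ≡⟨ occurrences-E (7 * j + c) ⟩
      Σᶠ ℓ (λ i → occurrences (7 * j + c) (blockAndConn i)) + occurrences (7 * j + c) links
        ≡⟨ cong (_+ occurrences (7 * j + c) links) (occurrences-blocks-beyond j c<7 ℓ≤j) ⟩
      occurrences (7 * j + c) links
        ≡⟨ cong (λ Y → occurrences Y links) (m+[n∸m]≡n (≮⇒≥ above)) ⟨
      occurrences (7 * ℓ + (7 * j + c ∸ 7 * ℓ)) links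
        ≤⟨ occurrences-links-above (7 * j + c ∸ 7 * ℓ) offset 0 blocks ⟩
      3 ∎
      where
      open ≤-Reasoning
      ℓ≤j : ℓ ≤ j
      ℓ≤j = ≮⇒≥ (λ j<ℓ → above (block-bound c<7 j<ℓ))

  maxDegree≤3 : totalSize blocks ≡ ℓ → MaxDegree≤ 3 G
  maxDegree≤3 size x = ≤-trans (neighbours-≤-occurrences (order G) (toℕ x) E) (occurrences-≤3 size (toℕ x))

  symmetric : Symmetric G
  symmetric v w = cong or (map-cong (edgeBetween-sym (toℕ v) (toℕ w)) E)

  vertexℕ<7ℓ : ∀ a (c : Fin 7) → vertexℕ (a % ℓ) (toℕ c) < 7 * ℓ
  vertexℕ<7ℓ a c = subst (_< 7 * ℓ) (sym (vertexℕ≡ (a % ℓ) (toℕ c))) (block-bound (Fin.toℕ<n c) (m%n<n a ℓ))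

  -- Block indices range over all of ℕ and are read modulo ℓ, so that the block after a is suc a.
  vertex : ℕ → Fin 7 → Fin (order G)
  vertex a c = fromℕ< (≤-trans (vertexℕ<7ℓ a c) (m≤m+n (7 * ℓ) (numTriples blocks)))

  toℕ-vertex : ∀ a c → toℕ (vertex a c) ≡ vertexℕ (a % ℓ) (toℕ c)
  toℕ-vertex a c = Fin.toℕ-fromℕ< _

  p q r s t u v : ℕ → Fin (order G)
  p a = vertex a 0F
  q a = vertex a 1F
  r a = vertex a 2F
  s a = vertex a 3F
  t a = vertex a 4F
  u a = vertex a 5F
  v a = vertex a 6F

  vertex-injective : ∀ {a b c d} → vertex a c ≡ vertex b d → a % ℓ ≡ b % ℓ × c ≡ d
  vertex-injective {a} {b} {c} {d} eq =
    let same-block , same-offset = block-injective (Fin.toℕ<n c) (Fin.toℕ<n d) (begin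
          7 * (a % ℓ) + toℕ c        ≡⟨ vertexℕ≡ (a % ℓ) (toℕ c) ⟨
          vertexℕ (a % ℓ) (toℕ c)    ≡⟨ toℕ-vertex a c ⟨
          toℕ (vertex a c)           ≡⟨ cong toℕ eq ⟩
          toℕ (vertex b d)           ≡⟨ toℕ-vertex b d ⟩
          vertexℕ (b % ℓ) (toℕ d)    ≡⟨ vertexℕ≡ (b % ℓ) (toℕ d) ⟩
          7 * (b % ℓ) + toℕ d        ∎)
    in same-block , Fin.toℕ-injective same-offset
    where open ≡-Reasoning

  offsets-differ : ∀ a c d → c ≢ d → vertex a c ≢ vertex a d
  offsets-differ a c d c≢d eq = c≢d (proj₂ (vertex-injective {a} {a} eq))

  blocks-differ : ∀ a c d → vertex a c ≢ vertex (suc a) d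
  blocks-differ a c d eq = %-distinct ℓ a {0} {1} (s≤s z≤n) (s≤s (s≤s z≤n))
    (trans (cong (_% ℓ) (+-identityʳ a)) (trans (proj₁ (vertex-injective {a} {suc a} {c} {d} eq)) (cong (_% ℓ) (+-comm 1 a))))

  edge⇒adj : ∀ {x y} → (toℕ x , toℕ y) ∈ E → Adj G x y
  edge⇒adj {x} {y} xy∈E = any⁺ (edgeBetween (toℕ x) (toℕ y)) (lose xy∈E (edgeBetween-self (toℕ x) (toℕ y)))

  adj-sym : ∀ x y → Adj G x y → Adj G y x
  adj-sym x y = subst T (symmetric x y)

  block-index : ℕ → Fin ℓ
  block-index a = fromℕ< (m%n<n a ℓ)

  toℕ-block-index : ∀ a → toℕ (block-index a) ≡ a % ℓ
  toℕ-block-index a = Fin.toℕ-fromℕ< (m%n<n a ℓ)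

  in-blockAndConn : ∀ a {e} → e ∈ blockAndConn (block-index a) → e ∈ E
  in-blockAndConn a e∈ = ∈-++⁺ˡ (∈-concatMap⁺ blockAndConn (lose (∈-allFin (block-index a)) e∈))

  block-adj : ∀ a {c d} → (vertexℕ (a % ℓ) (toℕ c) , vertexℕ (a % ℓ) (toℕ d)) ∈ blockEdges (a % ℓ) →
              Adj G (vertex a c) (vertex a d)
  block-adj a {c} {d} e∈ = edge⇒adj (subst₂ (λ x y → (x , y) ∈ E) (sym (toℕ-vertex a c)) (sym (toℕ-vertex a d))
    (in-blockAndConn a (∈-++⁺ˡ (subst (λ i → (vertexℕ (a % ℓ) (toℕ c) , vertexℕ (a % ℓ) (toℕ d)) ∈ blockEdges i)
                                      (sym (toℕ-block-index a)) e∈))))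

  p~t : ∀ a → Adj G (p a) (t a)
  p~t a = block-adj a {0F} {4F} (here refl)
  t~q : ∀ a → Adj G (t a) (q a)
  t~q a = block-adj a {4F} {1F} (there (here refl))
  q~r : ∀ a → Adj G (q a) (r a)
  q~r a = block-adj a {1F} {2F} (there (there (here refl)))
  r~s : ∀ a → Adj G (r a) (s a)
  r~s a = block-adj a {2F} {3F} (there (there (there (here refl))))
  s~p : ∀ a → Adj G (s a) (p a)
  s~p a = block-adj a {3F} {0F} (there (there (there (there (here refl)))))
  u~v : ∀ a → Adj G (u a) (v a)
  u~v a = block-adj a {5F} {6F} (there (there (there (there (there (here refl))))))
  u~p : ∀ a → Adj G (u a) (p a)
  u~p a = block-adj a {5F} {0F} (there (there (there (there (there (there (here refl)))))))
  v~q : ∀ a → Adj G (v a) (q a)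
  v~q a = block-adj a {6F} {1F} (there (there (there (there (there (there (there (here refl))))))))

  t~p : ∀ a → Adj G (t a) (p a)
  t~p a = adj-sym (p a) (t a) (p~t a)
  q~t : ∀ a → Adj G (q a) (t a)
  q~t a = adj-sym (t a) (q a) (t~q a)
  r~q : ∀ a → Adj G (r a) (q a)
  r~q a = adj-sym (q a) (r a) (q~r a)
  s~r : ∀ a → Adj G (s a) (r a)
  s~r a = adj-sym (r a) (s a) (r~s a)
  p~s : ∀ a → Adj G (p a) (s a)
  p~s a = adj-sym (s a) (p a) (s~p a)
  v~u : ∀ a → Adj G (v a) (u a)
  v~u a = adj-sym (u a) (v a) (u~v a)
  p~u : ∀ a → Adj G (p a) (u a)
  p~u a = adj-sym (u a) (p a) (u~p a)
  q~v : ∀ a → Adj G (q a) (v a)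
  q~v a = adj-sym (v a) (q a) (v~q a)

  next-% : ∀ a → suc (a % ℓ) % ℓ ≡ suc a % ℓ
  next-% a = sym (%-distribˡ-+ 1 a ℓ)

  conn-edge⇒adj : ∀ a c d → let i = block-index a in
    (vertexℕ (toℕ i) (toℕ c) , vertexℕ (suc (toℕ i) % ℓ) (toℕ d)) ∈ connEdges ℓ (conn i) (toℕ i) →
    Adj G (vertex a c) (vertex (suc a) d)
  conn-edge⇒adj a c d e∈ = edge⇒adj (subst₂ (λ x y → (x , y) ∈ E)
    (trans (cong (λ k → vertexℕ k (toℕ c)) (toℕ-block-index a)) (sym (toℕ-vertex a c)))
    (trans (cong (λ k → vertexℕ (suc k % ℓ) (toℕ d)) (toℕ-block-index a))
           (trans (cong (λ k → vertexℕ k (toℕ d)) (next-% a)) (sym (toℕ-vertex (suc a) d))))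
    (in-blockAndConn a (∈-++⁺ʳ (blockEdges (toℕ (block-index a))) e∈)))

  conn-adj : ∀ a → (Adj G (s a) (r (suc a)) × Adj G (v a) (u (suc a))) ⊎
                   (Adj G (s a) (u (suc a)) × Adj G (v a) (r (suc a)))
  conn-adj a = by-orientation (conn (block-index a)) (conn-edge⇒adj a)
    where
    i : ℕ
    i = toℕ (block-index a)
    by-orientation : ∀ b → (∀ c d → (vertexℕ i (toℕ c) , vertexℕ (suc i % ℓ) (toℕ d)) ∈ connEdges ℓ b i →
                                    Adj G (vertex a c) (vertex (suc a) d)) →
                     (Adj G (s a) (r (suc a)) × Adj G (v a) (u (suc a))) ⊎
                     (Adj G (s a) (u (suc a)) × Adj G (v a) (r (suc a)))
    by-orientation true  cross = inj₁ (cross 3F 2F (here refl) , cross 6F 5F (there (here refl)))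
    by-orientation false cross = inj₂ (cross 3F 5F (here refl) , cross 6F 2F (there (here refl)))

  first-triple : ∀ a m bs → 1 ≤ numTriples bs → ∃[ a′ ]
    (7 * ℓ + m , tMod ℓ a′) ∈ linkEdges ℓ a m bs ×
    (7 * ℓ + m , tMod ℓ (a′ + 1)) ∈ linkEdges ℓ a m bs ×
    (7 * ℓ + m , tMod ℓ (a′ + 2)) ∈ linkEdges ℓ a m bs
  first-triple a m (true  ∷ bs) _    = a , here refl , there (here refl) , there (there (here refl))
  first-triple a m (false ∷ bs) σ≥1 =
    let a′ , e₀ , e₁ , e₂ = first-triple (a + 2) m bs σ≥1 in a′ , there e₀ , there e₁ , there e₂

  module _ (triple : 1 ≤ numTriples blocks) where

    z : Fin (order G)
    z = fromℕ< (+-monoʳ-< (7 * ℓ) triple)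

    toℕ-z : toℕ z ≡ 7 * ℓ + 0
    toℕ-z = Fin.toℕ-fromℕ< (+-monoʳ-< (7 * ℓ) triple)

    vertex≢z : ∀ a c → vertex a c ≢ z
    vertex≢z a c eq = <⇒≢ (≤-trans (vertexℕ<7ℓ a c) (≤-reflexive (sym (+-identityʳ (7 * ℓ)))))
                          (trans (sym (toℕ-vertex a c)) (trans (cong toℕ eq) toℕ-z))

    z~t : ∀ a → (7 * ℓ + 0 , tMod ℓ a) ∈ links → Adj G z (t a)
    z~t a e∈ = edge⇒adj (subst₂ (λ x y → (x , y) ∈ E) (sym toℕ-z) (sym (toℕ-vertex a 4F))
                                  (∈-++⁺ʳ (concatMap blockAndConn (allFin ℓ)) e∈))

    link-triangle : ∃[ a ] Adj G z (t a) × Adj G z (t (suc a)) × Adj G z (t (suc (suc a)))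
    link-triangle =
      let a , e₀ , e₁ , e₂ = first-triple offset 0 blocks triple
      in a , z~t a e₀ , subst (Adj G z ∘ t) (+-comm a 1) (z~t (a + 1) e₁)
                      , subst (Adj G z ∘ t) (+-comm a 2) (z~t (a + 2) e₂)

    module _ (size : totalSize blocks ≡ ℓ) {C : Fin (order G) → Set} (code : PerfectCode G C) where

      open PerfectCode code

      private
        clash : ∀ x a b → Adj G x a → Adj G x b → C a → C b → a ≢ b → ⊥
        clash = no-two-code-neighbours code

        among : ∀ x a b c → Adj G x a → Adj G x b → Adj G x c → a ≢ b → a ≢ c → b ≢ c → ¬ C x →
                C a ⊎ C b ⊎ C c
        among = code-neighbour-among code (maxDegree≤3 size)

      t∉C⇒p∉C : ∀ a → ¬ C (t a) → ¬ C (p a)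
      t∉C⇒p∉C a ¬ct cp = ¬¬-excluded-middle λ
        { (yes cq) → clash (t a) (p a) (q a) (t~p a) (t~q a) cp cq (offsets-differ a 0F 1F (λ ()))
        ; (no ¬cq) → case among (q a) (t a) (r a) (v a) (q~t a) (q~r a) (q~v a)
                     (offsets-differ a 4F 2F (λ ())) (offsets-differ a 4F 6F (λ ())) (offsets-differ a 2F 6F (λ ()))
                     ¬cq of λ
            { (inj₁ ct)        → ¬ct ct
            ; (inj₂ (inj₁ cr)) → clash (s a) (p a) (r a) (s~p a) (s~r a) cp cr (offsets-differ a 0F 2F (λ ()))
            ; (inj₂ (inj₂ cv)) → clash (u a) (p a) (v a) (u~p a) (u~v a) cp cv (offsets-differ a 0F 6F (λ ()))
            }
        }

      t∉C⇒q∉C : ∀ a → ¬ C (t a) → ¬ C (q a)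
      t∉C⇒q∉C a ¬ct cq = ¬¬-excluded-middle λ
        { (yes cp) → clash (t a) (p a) (q a) (t~p a) (t~q a) cp cq (offsets-differ a 0F 1F (λ ()))
        ; (no ¬cp) → case among (p a) (t a) (s a) (u a) (p~t a) (p~s a) (p~u a)
                     (offsets-differ a 4F 3F (λ ())) (offsets-differ a 4F 5F (λ ())) (offsets-differ a 3F 5F (λ ()))
                     ¬cp of λ
            { (inj₁ ct)        → ¬ct ct
            ; (inj₂ (inj₁ cs)) → clash (r a) (q a) (s a) (r~q a) (r~s a) cq cs (offsets-differ a 1F 3F (λ ()))
            ; (inj₂ (inj₂ cu)) → clash (v a) (q a) (u a) (v~q a) (v~u a) cq cu (offsets-differ a 1F 5F (λ ()))
            }
        }

      t∉C⇒z∈C : ∀ a → Adj G (t a) z → ¬ C (t a) → C z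
      t∉C⇒z∈C a t~z ¬ct =
        case among (t a) (p a) (q a) z (t~p a) (t~q a) t~z
                   (offsets-differ a 0F 1F (λ ())) (vertex≢z a 0F) (vertex≢z a 1F) ¬ct of λ
          { (inj₁ cp)        → ⊥-elim (t∉C⇒p∉C a ¬ct cp)
          ; (inj₂ (inj₁ cq)) → ⊥-elim (t∉C⇒q∉C a ¬ct cq)
          ; (inj₂ (inj₂ cz)) → cz
          }

      code-pair : ∀ a → Adj G (t a) z → C z → (C (s a) × C (v a)) ⊎ (C (r a) × C (u a))
      code-pair a t~z cz = pair (dominated-via p-options) (dominated-via q-options)
        where
        ¬ct : ¬ C (t a)
        ¬ct ct = independent (t a) z t~z ct cz
        dominated-via : ∀ {X Y} → C (t a) ⊎ X ⊎ Y → X ⊎ Y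
        dominated-via (inj₁ ct) = ⊥-elim (¬ct ct)
        dominated-via (inj₂ x⊎y) = x⊎y
        p-options : C (t a) ⊎ C (s a) ⊎ C (u a)
        p-options = among (p a) (t a) (s a) (u a) (p~t a) (p~s a) (p~u a)
          (offsets-differ a 4F 3F (λ ())) (offsets-differ a 4F 5F (λ ())) (offsets-differ a 3F 5F (λ ()))
          (λ cp → clash (t a) (p a) z (t~p a) t~z cp cz (vertex≢z a 0F))
        q-options : C (t a) ⊎ C (r a) ⊎ C (v a)
        q-options = among (q a) (t a) (r a) (v a) (q~t a) (q~r a) (q~v a)
          (offsets-differ a 4F 2F (λ ())) (offsets-differ a 4F 6F (λ ())) (offsets-differ a 2F 6F (λ ()))
          (λ cq → clash (t a) (q a) z (t~q a) t~z cq cz (vertex≢z a 1F))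
        pair : C (s a) ⊎ C (u a) → C (r a) ⊎ C (v a) → (C (s a) × C (v a)) ⊎ (C (r a) × C (u a))
        pair (inj₁ cs) (inj₁ cr) = ⊥-elim (independent (r a) (s a) (r~s a) cr cs)
        pair (inj₁ cs) (inj₂ cv) = inj₁ (cs , cv)
        pair (inj₂ cu) (inj₁ cr) = inj₂ (cr , cu)
        pair (inj₂ cu) (inj₂ cv) = ⊥-elim (independent (u a) (v a) (u~v a) cu cv)

      forward-clash : ∀ a → C (s a) → C (v a) → Adj G (t (suc a)) z → C z → ⊥
      forward-clash a cs cv t′~z cz = clash-with predecessor (code-pair (suc a) t′~z cz)
        where
        predecessor : ∃[ c ] Adj G (r (suc a)) (vertex a c) × C (vertex a c)
        predecessor = case conn-adj a of λ
          { (inj₁ (s~r′ , _)) → 3F , adj-sym (s a) (r (suc a)) s~r′ , cs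
          ; (inj₂ (_ , v~r′)) → 6F , adj-sym (v a) (r (suc a)) v~r′ , cv
          }
        clash-with : ∃[ c ] Adj G (r (suc a)) (vertex a c) × C (vertex a c) →
                     (C (s (suc a)) × C (v (suc a))) ⊎ (C (r (suc a)) × C (u (suc a))) → ⊥
        clash-with (c , r′~x , cx) (inj₁ (cs′ , _)) =
          clash (r (suc a)) (s (suc a)) (vertex a c) (r~s (suc a)) r′~x cs′ cx
                (λ eq → blocks-differ a c 3F (sym eq))
        clash-with (c , r′~x , cx) (inj₂ (cr′ , _)) = independent (r (suc a)) (vertex a c) r′~x cr′ cx

      backward-clash : ∀ a → C (r (suc a)) → C (u (suc a)) → Adj G (t a) z → C z → ⊥
      backward-clash a cr′ cu′ t~z cz = clash-with successor (code-pair a t~z cz)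
        where
        successor : ∃[ d ] Adj G (s a) (vertex (suc a) d) × C (vertex (suc a) d)
        successor = case conn-adj a of λ
          { (inj₁ (s~r′ , _)) → 2F , s~r′ , cr′
          ; (inj₂ (s~u′ , _)) → 5F , s~u′ , cu′
          }
        clash-with : ∃[ d ] Adj G (s a) (vertex (suc a) d) × C (vertex (suc a) d) →
                     (C (s a) × C (v a)) ⊎ (C (r a) × C (u a)) → ⊥
        clash-with (d , s~y , cy) (inj₁ (cs , _)) = independent (s a) (vertex (suc a) d) s~y cs cy
        clash-with (d , s~y , cy) (inj₂ (cr , _)) =
          clash (s a) (r a) (vertex (suc a) d) (s~r a) s~y cr cy (blocks-differ a 2F d)

      no-code-around : ∀ a → Adj G z (t a) → Adj G z (t (suc a)) → Adj G z (t (suc (suc a))) → ⊥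
      no-code-around a z~t₀ z~t₁ z~t₂ = ¬¬-excluded-middle λ
        { (yes ct₀) → ¬¬-excluded-middle λ
            { (yes ct₁) → clash z (t a) (t (suc a)) z~t₀ z~t₁ ct₀ ct₁ (blocks-differ a 4F 4F)
            ; (no ¬ct₁) → independent z (t a) z~t₀ (t∉C⇒z∈C (suc a) t₁~z ¬ct₁) ct₀
            }
        ; (no ¬ct₀) → around-code (t∉C⇒z∈C a t₀~z ¬ct₀)
        }
        where
        t₀~z : Adj G (t a) z
        t₀~z = adj-sym z (t a) z~t₀
        t₁~z : Adj G (t (suc a)) z
        t₁~z = adj-sym z (t (suc a)) z~t₁
        around-code : C z → ⊥
        around-code cz = case code-pair (suc a) t₁~z cz of λ
          { (inj₁ (cs , cv)) → forward-clash (suc a) cs cv (adj-sym z (t (suc (suc a))) z~t₂) cz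
          ; (inj₂ (cr , cu)) → backward-clash a cr cu t₀~z cz
          }

      no-perfect-code : ⊥
      no-perfect-code = let a , z~t₀ , z~t₁ , z~t₂ = link-triangle in no-code-around a z~t₀ z~t₁ z~t₂

⌈/4⌉+1≤ : ∀ {m w} → m + 4 ≤ 4 * w → ⌈ m /4⌉ + 1 ≤ w
⌈/4⌉+1≤ {m} {w} m+4≤4w =
  subst (_≤ w) (+-comm 1 ((m + 3) / 4)) (m<n*o⇒m/o<n (subst₂ _≤_ (+-suc m 3) (*-comm 4 w) m+4≤4w))

theorem5p5 : (k : ℕ) → 4 ≤ k →
    (ℓ : ℕ) → 3 ≤ ℓ → ℓ % 2 ≡ 1 →
    (conn : Fin ℓ → Bool) → (offset : ℕ) → offset < ℓ →
    (blocks : List Bool) → totalSize blocks ≡ ℓ →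
    (σ : ℕ) → numTriples blocks ≡ σ →
    σ % 2 ≡ 1 → 1 ≤ σ → 3 * σ ≤ ℓ →
    (n : ℕ) → n ≡ 7 * ℓ + σ →
    iKR-≥ k (LP0Snark ℓ conn offset blocks) (⌈ (k + 1) * n /4⌉ + 1)
theorem5p5 k 4≤k (suc (suc (suc l))) (s≤s (s≤s (s≤s _))) _ conn offset _ blocks size _ refl _ 1≤σ _ _ refl
           f krdf indep =
  [ (λ perfect → ⊥-elim (no-perfect-code 1≤σ size (support-perfectCode 1≤k krdf indep perfect))) , ⌈/4⌉+1≤ ]′
    (Discharging.perfect-code-or-weight-bound G symmetric (maxDegree≤3 size) 4≤k krdf indep)
  where
  open LP₀ (suc l) conn offset blocks
  1≤k : 1 ≤ k
  1≤k = ≤-trans (s≤s z≤n) 4≤k
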